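{- Let $G$ be an extremal brick and let $u$ be a vertex of degree $3$ in $G$. If the graph $G-u-N(u)$ (obtained by deleting $u$ and all its neighbours) has exactly one perfect matching, then the graph $G\langle u\rangle$ obtained from $G$ by triangle-insertion at $u$ is an extremal brick.
   Context: Graphs are finite, loopless, and may have multiple edges. $N(u)$ denotes the set of neighbours of $u$. A connected graph with at least two vertices is matching covered if every edge lies in some perfect matching. For $X\subseteq V(G)$, $\partial_G(X)$ is the set of edges with exactly one end in $X$; such a cut is tight if every perfect matching contains exactly one of its edges, and trivial if $|X|=1$ or $|V(G)\setminus X|=1$. A brick is a nonbipartite matching covered graph with no nontrivial tight cuts (equivalently, a 3-connected graph $G$ such that $G-\{x,y\}$ has a perfect matching for all distinct $x,y$). A brick $G$ is extremal if its number of perfect matchings equals $|E(G)|-|V(G)|+1$. Triangle-insertion at a vertex $u$ of degree $3$ with incident edges $ua_1,ua_2,ua_3$: delete $u$, add three new vertices $b_1,b_2,b_3$ forming a triangle, and add edges $a_jb_j$, $j=1,2,3$. -}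

module Defs where

open import Data.Nat using (ℕ; suc; _+_; _≤_)
open import Data.Bool using (Bool)
open import Data.Fin using (Fin; zero; suc; _↑ˡ_; _↑ʳ_; splitAt; _≟_)
open import Data.Fin.Subset using (Subset; _∈_; _∉_; ∣_∣; ∁)
open import Data.Fin.Subset.Properties using (_∈?_)
open import Data.List using (List; length; filter; allFin)
open import Data.List.Relation.Unary.Unique.Propositional using (Unique)
import Data.List.Membership.Propositional as Mem
open import Data.Product using (Σ; ∃; _×_; _,_)
open import Data.Sum using (_⊎_; [_,_])
open import Data.Empty using (⊥)
open import Relation.Nullary using (¬_; Dec; yes; no)
open import Relation.Nullary.Decidable using (_⊎-dec_; _×-dec_; ¬?)
open import Relation.Binary.PropositionalEquality using (_≡_; _≢_)
open import Function.Bundles using (_⇔_)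

-- Finite multigraphs: vertex set Fin n, edge set Fin m, each edge e has
-- ends endA e and endB e (parallel edges allowed).

record Graph : Set where
  field
    n    : ℕ
    m    : ℕ
    endA : Fin m → Fin n
    endB : Fin m → Fin n
open Graph public

Loopless : Graph → Set
Loopless G = ∀ e → endA G e ≢ endB G e

Incident : (G : Graph) → Fin (m G) → Fin (n G) → Set
Incident G e v = endA G e ≡ v ⊎ endB G e ≡ v

incident? : (G : Graph) → ∀ e v → Dec (Incident G e v)
incident? G e v = (endA G e ≟ v) ⊎-dec (endB G e ≟ v)

deg : (G : Graph) → Fin (n G) → ℕ
deg G v = length (filter (λ e → incident? G e v) (allFin (m G)))

Adjacent : (G : Graph) → Fin (n G) → Fin (n G) → Set
Adjacent G u v = ∃ λ e → (endA G e ≡ u × endB G e ≡ v) ⊎ (endA G e ≡ v × endB G e ≡ u)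

ClosedNbhd : (G : Graph) → Fin (n G) → Fin (n G) → Set
ClosedNbhd G u v = v ≡ u ⊎ Adjacent G u v

degIn : (G : Graph) → Subset (m G) → Fin (n G) → ℕ
degIn G M v = length (filter (λ e → (e ∈? M) ×-dec incident? G e v) (allFin (m G)))

-- Perfect matchings of G - S (S a set of vertices, given as a predicate):
-- edge sets M ⊆ E(G) all of whose edges avoid S (i.e. M ⊆ E(G - S)) such that
-- every vertex not in S is incident with exactly one edge of M.

IsPMMinus : (G : Graph) → (Fin (n G) → Set) → Subset (m G) → Set
IsPMMinus G S M =
  (∀ e → e ∈ M → ¬ S (endA G e) × ¬ S (endB G e)) ×
  (∀ v → ¬ S v → degIn G M v ≡ 1)

noVertex : (G : Graph) → Fin (n G) → Set
noVertex G v = ⊥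

IsPM : (G : Graph) → Subset (m G) → Set
IsPM G = IsPMMinus G (noVertex G)

NumPMMinus : (G : Graph) → (Fin (n G) → Set) → ℕ → Set
NumPMMinus G S k = Σ (List (Subset (m G))) λ xs →
  Unique xs × length xs ≡ k × (∀ M → (M Mem.∈ xs) ⇔ IsPMMinus G S M)

NumPM : Graph → ℕ → Set
NumPM G = NumPMMinus G (noVertex G)

data Reach (G : Graph) : Fin (n G) → Fin (n G) → Set where
  here : ∀ {v} → Reach G v v
  step : ∀ {u v w} → Reach G u v → Adjacent G v w → Reach G u w

Connected : Graph → Set
Connected G = ∀ u v → Reach G u v

Bipartite : Graph → Set
Bipartite G = Σ (Fin (n G) → Bool) λ c → ∀ e → c (endA G e) ≢ c (endB G e)

MatchingCovered : Graph → Set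
MatchingCovered G =
  Connected G × 2 ≤ n G × (∀ e → ∃ λ M → IsPM G M × e ∈ M)

InCut : (G : Graph) → Subset (n G) → Fin (m G) → Set
InCut G X e = (endA G e ∈ X × endB G e ∉ X) ⊎ (endA G e ∉ X × endB G e ∈ X)

inCut? : (G : Graph) → ∀ X e → Dec (InCut G X e)
inCut? G X e = ((endA G e ∈? X) ×-dec ¬? (endB G e ∈? X))
           ⊎-dec (¬? (endA G e ∈? X) ×-dec (endB G e ∈? X))

cutIn : (G : Graph) → Subset (n G) → Subset (m G) → ℕ
cutIn G X M = length (filter (λ e → (e ∈? M) ×-dec inCut? G X e) (allFin (m G)))

TightCut : (G : Graph) → Subset (n G) → Set
TightCut G X = ∀ M → IsPM G M → cutIn G X M ≡ 1

TrivialCut : (G : Graph) → Subset (n G) → Set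
TrivialCut G X = ∣ X ∣ ≡ 1 ⊎ ∣ ∁ X ∣ ≡ 1

Brick : Graph → Set
Brick G = ¬ Bipartite G × MatchingCovered G × (∀ X → TightCut G X → TrivialCut G X)

Extremal : Graph → Set
Extremal G = Brick G × ∃ λ k → NumPM G k × k + n G ≡ m G + 1

-- Triangle insertion at u (of degree 3, incident edges e₁, e₂, e₃).
-- Up to isomorphism: vertex u is reused as b₁ (still joined by e₁ to a₁),
-- two new vertices b₂ = n, b₃ = n+1; the u-end of e₂ is moved to b₂, the
-- u-end of e₃ to b₃; three new edges b₁b₂, b₂b₃, b₁b₃ are added.

module _ (G : Graph) (u : Fin (n G)) (e₂ e₃ : Fin (m G)) where
  private
    N = n G
    old : Fin N → Fin (N + 2)
    old v = v ↑ˡ 2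
    b₁ b₂ b₃ : Fin (N + 2)
    b₁ = old u
    b₂ = N ↑ʳ zero
    b₃ = N ↑ʳ suc zero

    moveEnd : Fin (m G) → Fin N → Fin (N + 2)
    moveEnd e x with x ≟ u | e ≟ e₂ | e ≟ e₃
    ... | yes _ | yes _ | _     = b₂
    ... | yes _ | no _  | yes _ = b₃
    ... | _     | _     | _     = old x

    triA triB : Fin 3 → Fin (N + 2)
    triA zero = b₁
    triA (suc zero) = b₂
    triA (suc (suc zero)) = b₁
    triB zero = b₂
    triB (suc zero) = b₃
    triB (suc (suc zero)) = b₃

  triangleInsert : Graph
  triangleInsert = record
    { n = N + 2
    ; m = m G + 3
    ; endA = λ f → [ (λ e → moveEnd e (endA G e)) , triA ] (splitAt (m G) f)
    ; endB = λ f → [ (λ e → moveEnd e (endB G e)) , triB ] (splitAt (m G) f)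
    }

module Submission where

-- A perfect matching of G uses exactly one edge eᵢ at u, and extends to H in exactly one way, by the
-- triangle edge opposite bᵢ. Every other perfect matching of H avoids the triangle, hence uses e₁, e₂, e₃
-- and restricts to a perfect matching of G - u - N(u); there is exactly one, M₀, and M₀ + e₁e₂e₃ is
-- perfect in H because the brick G gives u three distinct neighbours. So H has one perfect matching more
-- than G, and |E| - |V| grows by one as well.
-- H is a brick: the triangle makes it non-bipartite, lifts cover all edges, and a tight cut of H
-- contracts (u placed by the parity of the cut on the triangle) to a tight, hence trivial, cut of G.
-- Of the cuts of H contracting to a trivial one, all but the trivial ones are crossed twice by
-- M₀ + e₁e₂e₃ or by the lift of a perfect matching using a suitable eᵢ.

open import Defs
open import Algebra.Bundles using (CommutativeRing)
open import Data.Bool using (Bool; true; false; not; _∨_; _∧_; _xor_; if_then_else_)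
import Data.Bool.Properties as Bool
open import Data.Empty using (⊥; ⊥-elim)
open import Data.Fin using (Fin; zero; suc; _↑ˡ_; _↑ʳ_; _≟_; splitAt)
open import Data.Fin.Properties using (splitAt-↑ˡ; splitAt-↑ʳ; ↑ˡ-injective; ↑ʳ-injective; join-splitAt)
open import Data.Fin.Subset using (Subset; _∈_; _∉_; ∣_∣; ∁)
open import Data.Fin.Subset.Properties using (_∈?_)
open import Data.List using ([]; _∷_; length; filter; tabulate; map)
open import Data.List.Properties using (length-map)
open import Data.List.Relation.Unary.Any using (here; there)
open import Data.List.Relation.Unary.AllPairs using (_∷_)
import Data.List.Relation.Unary.All as All
import Data.List.Relation.Unary.All.Properties as All
import Data.List.Relation.Unary.Unique.Propositional.Properties as Unique
import Data.List.Membership.Propositional as List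
import Data.List.Membership.Propositional.Properties as List
open import Data.Nat using (ℕ; zero; suc; _+_; _*_; _≤_; _≤?_; s≤s)
open import Data.Nat.Properties
  using (+-0-commutativeMonoid; +-assoc; +-identityʳ; *-zeroʳ; *-identityʳ; +-cancelʳ-≡; ≤-trans; m≤m+n; ≤-pred; ≰⇒>;
         suc-injective; m+n≡0⇒m≡0; m+n≡0⇒n≡0; m*n≡1⇒m≡1; m*n≡1⇒n≡1)
open import Data.Nat.Tactic.RingSolver using (solve-∀)
open import Data.Product using (Σ; ∃; _×_; _,_; proj₁; proj₂)
open import Data.Sum using (_⊎_; inj₁; inj₂; [_,_])
open import Data.Vec using (lookup; _++_; []; _∷_)
import Data.Vec as Vec
open import Data.Vec.Properties
  using ([]=⇒lookup; lookup⇒[]=; lookup-map; lookup∘tabulate; tabulate∘lookup; tabulate-cong; lookup-++ˡ; lookup-++ʳ; ++-injectiveˡ)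
open import Function using (_∘_; id)
open import Function.Bundles using (mk⇔; Equivalence)
open import Relation.Binary.PropositionalEquality hiding ([_])
open import Relation.Nullary using (¬_; Dec; yes; no; does; contradiction)
open import Relation.Nullary.Decidable using (_⊎-dec_; _×-dec_)
open import Relation.Unary using (Pred; Decidable)
open import Algebra.Properties.CommutativeMonoid.Sum +-0-commutativeMonoid
  using (sum; sum-cong-≗; ∑-distrib-+)
open import Algebra.Solver.CommutativeMonoid (CommutativeRing.+-commutativeMonoid Bool.xor-∧-commutativeRing)
  using (_⊕_; _⊜_) renaming (solve to solve-xor)

bit : Bool → ℕ
bit true = 1
bit false = 0

bit≡1⇒ : ∀ {b} → bit b ≡ 1 → b ≡ true
bit≡1⇒ {true} _ = refl

bit≡0⇒ : ∀ {b} → bit b ≡ 0 → b ≡ false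
bit≡0⇒ {false} _ = refl

χ : ∀ {k} → Subset k → Fin k → ℕ
χ p i = bit (lookup p i)

𝟙 : ∀ {a} {A : Set a} → Dec A → ℕ
𝟙 (yes _) = 1
𝟙 (no _) = 0

𝟙-yes : ∀ {a} {A : Set a} (d : Dec A) → A → 𝟙 d ≡ 1
𝟙-yes (yes _) _ = refl
𝟙-yes (no ¬a) a = ⊥-elim (¬a a)

𝟙-no : ∀ {a} {A : Set a} (d : Dec A) → ¬ A → 𝟙 d ≡ 0
𝟙-no (yes a) ¬a = ⊥-elim (¬a a)
𝟙-no (no _) _ = refl

𝟙≡1⇒ : ∀ {a} {A : Set a} (d : Dec A) → 𝟙 d ≡ 1 → A
𝟙≡1⇒ (yes a) _ = a

𝟙-cong : ∀ {a b} {A : Set a} {B : Set b} (d : Dec A) (d′ : Dec B) → (A → B) → (B → A) → 𝟙 d ≡ 𝟙 d′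
𝟙-cong (yes a) d′ f g = sym (𝟙-yes d′ (f a))
𝟙-cong (no ¬a) d′ f g = sym (𝟙-no d′ (λ b → ¬a (g b)))

𝟙-× : ∀ {a b} {A : Set a} {B : Set b} (d : Dec A) (d′ : Dec B) → 𝟙 (d ×-dec d′) ≡ 𝟙 d * 𝟙 d′
𝟙-× (yes _) (yes _) = refl
𝟙-× (yes _) (no _) = refl
𝟙-× (no _) _ = refl

false⇒∉ : ∀ {k} {x : Fin k} {p : Subset k} → lookup p x ≡ false → x ∉ p
false⇒∉ x∉p x∈p = contradiction (trans (sym ([]=⇒lookup x∈p)) x∉p) λ ()

𝟙-∈ : ∀ {k} (x : Fin k) (p : Subset k) → 𝟙 (x ∈? p) ≡ χ p x
𝟙-∈ x p with lookup p x in eq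
... | true = 𝟙-yes (x ∈? p) (lookup⇒[]= x p eq)
... | false = 𝟙-no (x ∈? p) (false⇒∉ eq)

sum-++ : ∀ k l (f : Fin (k + l) → ℕ) → sum f ≡ sum (λ i → f (i ↑ˡ l)) + sum (λ j → f (k ↑ʳ j))
sum-++ zero l f = refl
sum-++ (suc k) l f = trans (cong (f zero +_) (sum-++ k l (λ i → f (suc i)))) (sym (+-assoc (f zero) _ _))

sum-zero : ∀ {k} (f : Fin k → ℕ) → (∀ i → f i ≡ 0) → sum f ≡ 0
sum-zero {zero} f f≡0 = refl
sum-zero {suc k} f f≡0 rewrite f≡0 zero = sum-zero (λ i → f (suc i)) (λ i → f≡0 (suc i))

sum≡0⇒ : ∀ {k} (f : Fin k → ℕ) → sum f ≡ 0 → ∀ i → f i ≡ 0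
sum≡0⇒ {suc k} f Σ≡0 zero = m+n≡0⇒m≡0 (f zero) Σ≡0
sum≡0⇒ {suc k} f Σ≡0 (suc i) = sum≡0⇒ (λ i → f (suc i)) (m+n≡0⇒n≡0 (f zero) Σ≡0) i

sum-single : ∀ {k} (f : Fin k → ℕ) (a : Fin k) → (∀ i → i ≢ a → f i ≡ 0) → sum f ≡ f a
sum-single {suc k} f zero f≡0 =
  trans (cong (f zero +_) (sum-zero (λ i → f (suc i)) (λ i → f≡0 (suc i) λ ()))) (+-identityʳ _)
sum-single {suc k} f (suc a) f≡0 rewrite f≡0 zero (λ ()) =
  sum-single (λ i → f (suc i)) a (λ i i≢a → f≡0 (suc i) λ where refl → i≢a refl)

sum≡1⇒ : ∀ {k} (f : Fin k → ℕ) → sum f ≡ 1 → Σ (Fin k) λ a → f a ≡ 1 × (∀ i → i ≢ a → f i ≡ 0)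
sum≡1⇒ {suc k} f Σ≡1 with f zero in f₀
... | zero with sum≡1⇒ (λ i → f (suc i)) Σ≡1
...   | a , fa≡1 , rest = suc a , fa≡1 , λ where
          zero _ → f₀
          (suc i) i≢a → rest i (λ where refl → i≢a refl)
sum≡1⇒ {suc k} f Σ≡1 | suc zero = zero , f₀ , λ where
  zero i≢0 → ⊥-elim (i≢0 refl)
  (suc i) _ → sum≡0⇒ (λ i → f (suc i)) (suc-injective Σ≡1) i

sum≡1-unique : ∀ {k} (f : Fin k → ℕ) → sum f ≡ 1 → ∀ {i j} → f i ≢ 0 → f j ≢ 0 → i ≡ j
sum≡1-unique f Σ≡1 {i} {j} fi≢0 fj≢0 with sum≡1⇒ f Σ≡1
... | a , _ , rest with i ≟ a | j ≟ a
...   | yes i≡a | yes j≡a = trans i≡a (sym j≡a)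
...   | no i≢a | _ = ⊥-elim (fi≢0 (rest i i≢a))
...   | yes _ | no j≢a = ⊥-elim (fj≢0 (rest j j≢a))

erase : ∀ {k} → Fin k → (Fin k → ℕ) → Fin k → ℕ
erase a f i with i ≟ a
... | yes _ = 0
... | no _ = f i

erase-≢ : ∀ {k} {a i : Fin k} (f : Fin k → ℕ) → i ≢ a → erase a f i ≡ f i
erase-≢ {a = a} {i} f i≢a with i ≟ a
... | yes i≡a = ⊥-elim (i≢a i≡a)
... | no _ = refl

erase-cong : ∀ {k} (a : Fin k) f g i → (i ≢ a → f i ≡ g i) → erase a f i ≡ erase a g i
erase-cong a f g i fi≡gi with i ≟ a
... | yes _ = refl
... | no i≢a = fi≡gi i≢a

sum-erase : ∀ {k} (f : Fin k → ℕ) (a : Fin k) → sum f ≡ f a + sum (erase a f)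
sum-erase f a = begin
  sum f                                       ≡⟨ sum-cong-≗ split ⟩
  sum (λ i → only i + erase a f i)            ≡⟨ ∑-distrib-+ only (erase a f) ⟩
  sum only + sum (erase a f)                  ≡⟨ cong (_+ sum (erase a f)) (sum-single only a only-≢) ⟩
  only a + sum (erase a f)                    ≡⟨ cong (_+ sum (erase a f)) only-a ⟩
  f a + sum (erase a f)                       ∎
  where
  open ≡-Reasoning
  only : Fin _ → ℕ
  only i with i ≟ a
  ... | yes _ = f i
  ... | no _ = 0
  only-≢ : ∀ i → i ≢ a → only i ≡ 0
  only-≢ i i≢a with i ≟ a
  ... | yes i≡a = ⊥-elim (i≢a i≡a)
  ... | no _ = refl
  only-a : only a ≡ f a
  only-a with a ≟ a
  ... | yes _ = refl
  ... | no a≢a = ⊥-elim (a≢a refl)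
  split : ∀ i → f i ≡ only i + erase a f i
  split i with i ≟ a
  ... | yes _ = sym (+-identityʳ _)
  ... | no _ = refl

sum-δ : ∀ {k} (f : Fin k → ℕ) (a : Fin k) → sum (λ i → f i * 𝟙 (i ≟ a)) ≡ f a
sum-δ f a = trans (sum-single _ a λ i i≢a → trans (cong (f i *_) (𝟙-no (i ≟ a) i≢a)) (*-zeroʳ (f i)))
  (trans (cong (f a *_) (𝟙-yes (a ≟ a) refl)) (*-identityʳ (f a)))

length-filter-tabulate : ∀ {a p} {A : Set a} {P : Pred A p} (P? : Decidable P) {k} (g : Fin k → A) →
  length (filter P? (tabulate g)) ≡ sum (λ i → 𝟙 (P? (g i)))
length-filter-tabulate P? {zero} g = refl
length-filter-tabulate P? {suc k} g with P? (g zero)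
... | yes _ = cong suc (length-filter-tabulate P? (λ i → g (suc i)))
... | no _ = length-filter-tabulate P? (λ i → g (suc i))

no-three-distinct : ∀ {k} → k ≤ 2 → {x y z : Fin k} → x ≢ y → x ≢ z → y ≢ z → ⊥
no-three-distinct {suc (suc (suc _))} (s≤s (s≤s ()))
no-three-distinct _ {zero} {zero} x≢y _ _ = x≢y refl
no-three-distinct _ {suc zero} {suc zero} x≢y _ _ = x≢y refl
no-three-distinct _ {zero} {suc zero} {zero} _ x≢z _ = x≢z refl
no-three-distinct _ {zero} {suc zero} {suc zero} _ _ y≢z = y≢z refl
no-three-distinct _ {suc zero} {zero} {zero} _ _ y≢z = y≢z refl
no-three-distinct _ {suc zero} {zero} {suc zero} _ x≢z _ = x≢z refl

third-element : ∀ {k} → 3 ≤ k → (x y : Fin k) → ∃ λ w → w ≢ x × w ≢ y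
third-element {suc (suc zero)} (s≤s (s≤s ()))
third-element {suc (suc (suc _))} _ x y with zero ≟ x | zero ≟ y
... | no 0≢x | no 0≢y = zero , 0≢x , 0≢y
... | yes refl | yes refl = suc zero , (λ ()) , (λ ())
... | yes refl | no _ with suc zero ≟ y
...   | no 1≢y = suc zero , (λ ()) , 1≢y
...   | yes refl = suc (suc zero) , (λ ()) , (λ ())
third-element {suc (suc (suc _))} _ x y | no _ | yes refl with suc zero ≟ x
...   | no 1≢x = suc zero , 1≢x , (λ ())
...   | yes refl = suc (suc zero) , (λ ()) , (λ ())

↑ˡ≢↑ʳ : ∀ {k l} (i : Fin k) (j : Fin l) → i ↑ˡ l ≢ k ↑ʳ j
↑ˡ≢↑ʳ {k} {l} i j p with trans (sym (splitAt-↑ˡ k i l)) (trans (cong (splitAt k) p) (splitAt-↑ʳ k l j))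
... | ()

subset-ext : ∀ {k} {p q : Subset k} → (∀ i → lookup p i ≡ lookup q i) → p ≡ q
subset-ext {p = p} {q} p≗q = trans (sym (tabulate∘lookup p)) (trans (tabulate-cong p≗q) (tabulate∘lookup q))

∣∣-sum : ∀ {k} (p : Subset k) → ∣ p ∣ ≡ sum (λ i → χ p i)
∣∣-sum [] = refl
∣∣-sum (true ∷ p) = cong suc (∣∣-sum p)
∣∣-sum (false ∷ p) = ∣∣-sum p

∣∁∣-sum : ∀ {k} (p : Subset k) → ∣ ∁ p ∣ ≡ sum (λ i → bit (not (lookup p i)))
∣∁∣-sum p = trans (∣∣-sum (∁ p)) (sum-cong-≗ λ i → cong bit (lookup-map i not p))

triple : ∀ {k} → Fin k → Fin k → Fin k → Subset k
triple x y z = Vec.tabulate λ v → does (v ≟ x) ∨ does (v ≟ y) ∨ does (v ≟ z)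

∈triple⇒ : ∀ {k} (x y z : Fin k) {v} → lookup (triple x y z) v ≡ true → v ≡ x ⊎ v ≡ y ⊎ v ≡ z
∈triple⇒ x y z {v} v∈ rewrite lookup∘tabulate (λ v → does (v ≟ x) ∨ does (v ≟ y) ∨ does (v ≟ z)) v
  with v ≟ x | v ≟ y | v ≟ z
... | yes v≡x | _ | _ = inj₁ v≡x
... | no _ | yes v≡y | _ = inj₂ (inj₁ v≡y)
... | no _ | no _ | yes v≡z = inj₂ (inj₂ v≡z)

⇒∈triple : ∀ {k} (x y z : Fin k) {v} → v ≡ x ⊎ v ≡ y ⊎ v ≡ z → lookup (triple x y z) v ≡ true
⇒∈triple x y z {v} v∈ rewrite lookup∘tabulate (λ v → does (v ≟ x) ∨ does (v ≟ y) ∨ does (v ≟ z)) v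
  with v ≟ x | v ≟ y | v ≟ z | v∈
... | yes _ | _ | _ | _ = refl
... | no _ | yes _ | _ | _ = refl
... | no _ | no _ | yes _ | _ = refl
... | no v≢x | no _ | no _ | inj₁ v≡x = ⊥-elim (v≢x v≡x)
... | no _ | no v≢y | no _ | inj₂ (inj₁ v≡y) = ⊥-elim (v≢y v≡y)
... | no _ | no _ | no v≢z | inj₂ (inj₂ v≡z) = ⊥-elim (v≢z v≡z)

data One₃ : Bool → Bool → Bool → Set where
  first : One₃ true false false
  second : One₃ false true false
  third : One₃ false false true

one₃ : ∀ x y z → bit x + bit y + bit z ≡ 1 → One₃ x y z
one₃ true false false _ = first
one₃ false true false _ = second
one₃ false false true _ = third

data Among₃ {k} (a b c : Fin k) : Fin k → Set where
  at₁ : Among₃ a b c a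
  at₂ : Among₃ a b c b
  at₃ : Among₃ a b c c
  elsewhere : ∀ {i} → i ≢ a → i ≢ b → i ≢ c → Among₃ a b c i

among₃ : ∀ {k} (a b c i : Fin k) → Among₃ a b c i
among₃ a b c i with i ≟ a | i ≟ b | i ≟ c
... | yes refl | _ | _ = at₁
... | no _ | yes refl | _ = at₂
... | no _ | no _ | yes refl = at₃
... | no i≢a | no i≢b | no i≢c = elsewhere i≢a i≢b i≢c

module _ {k} (a b c : Fin k) where

  erase₃ : (Fin k → ℕ) → Fin k → ℕ
  erase₃ f = erase c (erase b (erase a f))

  erase₃-elsewhere : ∀ f {i} → i ≢ a → i ≢ b → i ≢ c → erase₃ f i ≡ f i
  erase₃-elsewhere f i≢a i≢b i≢c =
    trans (erase-≢ _ i≢c) (trans (erase-≢ _ i≢b) (erase-≢ f i≢a))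

  sum-erase₃ : a ≢ b → a ≢ c → b ≢ c → ∀ f → sum f ≡ sum (erase₃ f) + f a + f b + f c
  sum-erase₃ a≢b a≢c b≢c f = begin
    sum f                                                   ≡⟨ sum-erase f a ⟩
    f a + sum f₁                                            ≡⟨ cong (f a +_) (sum-erase f₁ b) ⟩
    f a + (f₁ b + sum f₂)                                   ≡⟨ cong (λ x → f a + (x + sum f₂)) (erase-≢ f (λ p → a≢b (sym p))) ⟩
    f a + (f b + sum f₂)                                    ≡⟨ cong (λ x → f a + (f b + x)) (sum-erase f₂ c) ⟩
    f a + (f b + (f₂ c + sum (erase₃ f)))                   ≡⟨ cong (λ x → f a + (f b + (x + sum (erase₃ f)))) f₂c ⟩
    f a + (f b + (f c + sum (erase₃ f)))                    ≡⟨ rearrange (f a) (f b) (f c) (sum (erase₃ f)) ⟩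
    sum (erase₃ f) + f a + f b + f c                        ∎
    where
    open ≡-Reasoning
    f₁ f₂ : Fin k → ℕ
    f₁ = erase a f
    f₂ = erase b f₁
    f₂c : f₂ c ≡ f c
    f₂c = trans (erase-≢ f₁ (λ p → b≢c (sym p))) (erase-≢ f (λ p → a≢c (sym p)))
    rearrange : ∀ x y z w → x + (y + (z + w)) ≡ w + x + y + z
    rearrange = solve-∀

  sum-erase₃-cong : ∀ f g → (∀ i → i ≢ a → i ≢ b → i ≢ c → f i ≡ g i) → sum (erase₃ f) ≡ sum (erase₃ g)
  sum-erase₃-cong f g f≗g = sum-cong-≗ λ i →
    erase-cong c _ _ i λ i≢c → erase-cong b _ _ i λ i≢b → erase-cong a f g i λ i≢a → f≗g i i≢a i≢b i≢c

module _ (G : Graph) where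

  degIn-sum : (M : Subset (m G)) (v : Fin (n G)) →
    degIn G M v ≡ sum (λ e → χ M e * 𝟙 (incident? G e v))
  degIn-sum M v = trans (length-filter-tabulate (λ e → (e ∈? M) ×-dec incident? G e v) (λ e → e))
    (sum-cong-≗ λ e → trans (𝟙-× (e ∈? M) (incident? G e v)) (cong (_* 𝟙 (incident? G e v)) (𝟙-∈ e M)))

  deg-sum : (v : Fin (n G)) → deg G v ≡ sum (λ e → 𝟙 (incident? G e v))
  deg-sum v = length-filter-tabulate (λ e → incident? G e v) (λ e → e)

  crosses : Subset (n G) → Fin (m G) → Bool
  crosses X e = lookup X (endA G e) xor lookup X (endB G e)

  𝟙-inCut : (X : Subset (n G)) (e : Fin (m G)) → 𝟙 (inCut? G X e) ≡ bit (crosses X e)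
  𝟙-inCut X e with lookup X (endA G e) in a∈X | lookup X (endB G e) in b∈X
  ... | true | true = 𝟙-no (inCut? G X e) λ where
          (inj₁ (_ , b∉X)) → b∉X (lookup⇒[]= _ X b∈X)
          (inj₂ (a∉X , _)) → a∉X (lookup⇒[]= _ X a∈X)
  ... | true | false = 𝟙-yes (inCut? G X e) (inj₁ (lookup⇒[]= _ X a∈X , false⇒∉ b∈X))
  ... | false | true = 𝟙-yes (inCut? G X e) (inj₂ (false⇒∉ a∈X , lookup⇒[]= _ X b∈X))
  ... | false | false = 𝟙-no (inCut? G X e) λ where
          (inj₁ (a∈X′ , _)) → false⇒∉ a∈X a∈X′
          (inj₂ (_ , b∈X′)) → false⇒∉ b∈X b∈X′

  cutIn-sum : (X : Subset (n G)) (M : Subset (m G)) →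
    cutIn G X M ≡ sum (λ e → χ M e * bit (crosses X e))
  cutIn-sum X M = trans (length-filter-tabulate (λ e → (e ∈? M) ×-dec inCut? G X e) (λ e → e))
    (sum-cong-≗ λ e → trans (𝟙-× (e ∈? M) (inCut? G X e)) (cong₂ _*_ (𝟙-∈ e M) (𝟙-inCut X e)))

  crossing-unique : ∀ {X M f g} → cutIn G X M ≡ 1 → lookup M f ≡ true → lookup M g ≡ true →
    crosses X f ≡ true → crosses X g ≡ true → f ≡ g
  crossing-unique {X} {M} {f} {g} cut≡1 f∈M g∈M f-crosses g-crosses =
    sum≡1-unique _ (trans (sym (cutIn-sum X M)) cut≡1) (counted f∈M f-crosses) (counted g∈M g-crosses)
    where
    counted : ∀ {e} → lookup M e ≡ true → crosses X e ≡ true → χ M e * bit (crosses X e) ≢ 0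
    counted e∈M e-crosses rewrite e∈M | e-crosses = λ ()

  cutIn-∁ : (X : Subset (n G)) (M : Subset (m G)) → cutIn G (∁ X) M ≡ cutIn G X M
  cutIn-∁ X M = begin
    cutIn G (∁ X) M                              ≡⟨ cutIn-sum (∁ X) M ⟩
    sum (λ e → χ M e * bit (crosses (∁ X) e))    ≡⟨ sum-cong-≗ (λ e → cong (λ b → χ M e * bit b) (crosses-∁ e)) ⟩
    sum (λ e → χ M e * bit (crosses X e))        ≡⟨ cutIn-sum X M ⟨
    cutIn G X M                                  ∎
    where
    open ≡-Reasoning
    crosses-∁ : ∀ e → crosses (∁ X) e ≡ crosses X e
    crosses-∁ e rewrite lookup-map (endA G e) not X | lookup-map (endB G e) not X =
      Bool.xor-annihilates-not (lookup X (endA G e)) (lookup X (endB G e))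

module _ (G : Graph) where

  Joins : Fin (m G) → Fin (n G) → Fin (n G) → Set
  Joins e x y = (endA G e ≡ x × endB G e ≡ y) ⊎ (endA G e ≡ y × endB G e ≡ x)

  joins-ends : ∀ e → Joins e (endA G e) (endB G e)
  joins-ends e = inj₁ (refl , refl)

  joins-sym : ∀ {e x y} → Joins e x y → Joins e y x
  joins-sym (inj₁ ends) = inj₂ ends
  joins-sym (inj₂ ends) = inj₁ ends

  joins-unique : ∀ {e x y x′ y′} → Joins e x y → Joins e x′ y′ → (x′ ≡ x × y′ ≡ y) ⊎ (x′ ≡ y × y′ ≡ x)
  joins-unique (inj₁ (refl , refl)) (inj₁ (p , q)) = inj₁ (sym p , sym q)
  joins-unique (inj₁ (refl , refl)) (inj₂ (p , q)) = inj₂ (sym q , sym p)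
  joins-unique (inj₂ (refl , refl)) (inj₁ (p , q)) = inj₂ (sym p , sym q)
  joins-unique (inj₂ (refl , refl)) (inj₂ (p , q)) = inj₁ (sym q , sym p)

  joins⇒incidentˡ : ∀ {e x y} → Joins e x y → Incident G e x
  joins⇒incidentˡ (inj₁ (p , _)) = inj₁ p
  joins⇒incidentˡ (inj₂ (_ , q)) = inj₂ q

  joins⇒incidentʳ : ∀ {e x y} → Joins e x y → Incident G e y
  joins⇒incidentʳ j = joins⇒incidentˡ (joins-sym j)

  incident⇒joins : ∀ {e w} → Incident G e w → ∃ λ z → Joins e w z
  incident⇒joins (inj₁ p) = _ , inj₁ (p , refl)
  incident⇒joins (inj₂ p) = _ , inj₂ (refl , p)

  incident⇒end : ∀ {e x y w} → Joins e x y → Incident G e w → x ≡ w ⊎ y ≡ w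
  incident⇒end (inj₁ (refl , refl)) inc = inc
  incident⇒end (inj₂ (refl , refl)) (inj₁ p) = inj₂ p
  incident⇒end (inj₂ (refl , refl)) (inj₂ p) = inj₁ p

  𝟙-incident : ∀ {e x y} → Joins e x y → ∀ w → 𝟙 (incident? G e w) ≡ 𝟙 ((x ≟ w) ⊎-dec (y ≟ w))
  𝟙-incident j w = 𝟙-cong _ _ (incident⇒end j) λ where
    (inj₁ refl) → joins⇒incidentˡ j
    (inj₂ refl) → joins⇒incidentʳ j

  𝟙-incident-no : ∀ {e x y w} → Joins e x y → x ≢ w → y ≢ w → 𝟙 (incident? G e w) ≡ 0
  𝟙-incident-no j x≢w y≢w = 𝟙-no _ λ e∋w → [ x≢w , y≢w ] (incident⇒end j e∋w)

  crosses-joins : ∀ {e x y} → Joins e x y → (X : Subset (n G)) → crosses G X e ≡ (lookup X x xor lookup X y)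
  crosses-joins (inj₁ (refl , refl)) X = refl
  crosses-joins {e} (inj₂ (refl , refl)) X = Bool.xor-comm (lookup X (endA G e)) _

  loopless-joins : Loopless G → ∀ {e x} → ¬ Joins e x x
  loopless-joins loopless {e} (inj₁ (p , q)) = loopless e (trans p (sym q))
  loopless-joins loopless {e} (inj₂ (p , q)) = loopless e (trans p (sym q))

  bipartite-joins : (c : Fin (n G) → Bool) → (∀ e → c (endA G e) ≢ c (endB G e)) → ∀ {e x y} → Joins e x y → c x ≢ c y
  bipartite-joins c proper {e} (inj₁ (refl , refl)) = proper e
  bipartite-joins c proper {e} (inj₂ (refl , refl)) = λ p → proper e (sym p)

module _ (G : Graph) {S : Fin (n G) → Set} {M : Subset (m G)} (pm : IsPMMinus G S M) where
  private
    incidence : Fin (n G) → Fin (m G) → ℕ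
    incidence v e = χ M e * 𝟙 (incident? G e v)

    incidence-sum : ∀ v → ¬ S v → sum (incidence v) ≡ 1
    incidence-sum v v∉S = trans (sym (degIn-sum G M v)) (proj₂ pm v v∉S)

  matched-edge : ∀ v → ¬ S v → ∃ λ e → lookup M e ≡ true × Incident G e v
  matched-edge v v∉S with sum≡1⇒ (incidence v) (incidence-sum v v∉S)
  ... | e , e↦1 , _ = e , bit≡1⇒ (m*n≡1⇒m≡1 (χ M e) _ e↦1) , 𝟙≡1⇒ (incident? G e v) (m*n≡1⇒n≡1 (χ M e) _ e↦1)

  degIn-avoided : ∀ {v} → S v → degIn G M v ≡ 0
  degIn-avoided {v} v∈S = trans (degIn-sum G M v) (sum-zero _ unmatched)
    where
    unmatched : ∀ e → χ M e * 𝟙 (incident? G e v) ≡ 0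
    unmatched e with lookup M e in e∈M
    ... | false = refl
    ... | true = cong (1 *_) (𝟙-no _ avoids)
      where
      avoids : ¬ Incident G e v
      avoids (inj₁ refl) = proj₁ (proj₁ pm e (lookup⇒[]= e M e∈M)) v∈S
      avoids (inj₂ refl) = proj₂ (proj₁ pm e (lookup⇒[]= e M e∈M)) v∈S

  matched-edge-unique : ∀ v → ¬ S v → ∀ {e e′} → lookup M e ≡ true → lookup M e′ ≡ true →
    Incident G e v → Incident G e′ v → e ≡ e′
  matched-edge-unique v v∉S {e} {e′} e∈M e′∈M e∋v e′∋v =
    sum≡1-unique (incidence v) (incidence-sum v v∉S) (counted e∈M e∋v) (counted e′∈M e′∋v)
    where
    counted : ∀ {f} → lookup M f ≡ true → Incident G f v → incidence v f ≢ 0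
    counted {f} f∈M f∋v rewrite f∈M | 𝟙-yes (incident? G f v) f∋v = λ ()

module _ {G : Graph} where

  reach-trans : ∀ {x y z} → Reach G x y → Reach G y z → Reach G x z
  reach-trans r here = r
  reach-trans r (step s a) = step (reach-trans r s) a

  reach-edge : ∀ {e x y} → Joins G e x y → Reach G x y
  reach-edge j = step here (_ , j)

  reach-sym : ∀ {x y} → Reach G x y → Reach G y x
  reach-sym here = here
  reach-sym (step r (e , j)) = reach-trans (reach-edge (joins-sym G j)) (reach-sym r)

  exit-edge : (P : Fin (n G) → Set) → (∀ v → Dec (P v)) → ∀ {s t} → Reach G s t → P s → ¬ P t →
    ∃ λ e → ∃ λ x → ∃ λ y → Joins G e x y × P x × ¬ P y
  exit-edge P P? here Ps ¬Pt = ⊥-elim (¬Pt Ps)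
  exit-edge P P? (step {v = v} r (e , j)) Ps ¬Pt with P? v
  ... | no ¬Pv = exit-edge P P? r Ps ¬Pv
  ... | yes Pv = e , v , _ , j , Pv , ¬Pt

module _ (G : Graph) (loopless : Loopless G) where

  matched-edge-at : ∀ {M} → IsPM G M → ∀ v → ∃ λ e → lookup M e ≡ true × Incident G e v
  matched-edge-at pm v = matched-edge G pm v λ ()

  joins-far-end : ∀ {e x y z} → Joins G e x y → Joins G e x z → z ≡ y
  joins-far-end j j′ with joins-unique G j j′
  ... | inj₁ (_ , z≡y) = z≡y
  ... | inj₂ (refl , refl) = ⊥-elim (loopless-joins G loopless j)

  lone-vertex-unmatchable : ∀ {S M} → IsPMMinus G S M → ∀ w → ¬ S w → (∀ {v} → ¬ S v → v ≡ w) → ⊥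
  lone-vertex-unmatchable {S} {M} pm w w∉S only-w with matched-edge G pm w w∉S
  ... | f , f∈M , f∋w with incident⇒joins G f∋w
  ...   | z , f-wz = loopless-joins G loopless (subst (Joins G f w) (only-w z∉S) f-wz)
    where
    z∉S : ¬ S z
    z∉S = [ (λ where refl → proj₁ (proj₁ pm f (lookup⇒[]= f M f∈M))) , (λ where refl → proj₂ (proj₁ pm f (lookup⇒[]= f M f∈M))) ]
          (joins⇒incidentʳ G f-wz)

  -- A perfect matching using an edge uy meets ∂{u, y, y′} only in the edge matching y′.
  cutIn-triple : ∀ {M eᵤ u y y′} (X : Subset (n G)) → IsPM G M → lookup M eᵤ ≡ true → Joins G eᵤ u y →
    y′ ≢ u → y′ ≢ y → (∀ v → lookup X v ≡ true → v ≡ u ⊎ v ≡ y ⊎ v ≡ y′) →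
    (∀ v → v ≡ u ⊎ v ≡ y ⊎ v ≡ y′ → lookup X v ≡ true) → cutIn G X M ≡ 1
  cutIn-triple {M} {eᵤ} {u} {y} {y′} X pm eᵤ∈M eᵤ-uy y′≢u y′≢y X⇒ ⇒X
    with matched-edge-at pm y′
  ... | f , f∈M , f∋y′ with incident⇒joins G f∋y′
  ...   | z , f-y′z = trans (cutIn-sum G X M) (trans (sum-single h f h≡0) hf≡1)
    where
    h : Fin (m G) → ℕ
    h e = χ M e * bit (crosses G X e)
    unique : ∀ v {e e′} → lookup M e ≡ true → lookup M e′ ≡ true → Incident G e v → Incident G e′ v → e ≡ e′
    unique v = matched-edge-unique G pm v λ ()
    f≢eᵤ : f ≢ eᵤ
    f≢eᵤ refl with incident⇒end G eᵤ-uy f∋y′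
    ... | inj₁ u≡y′ = y′≢u (sym u≡y′)
    ... | inj₂ y≡y′ = y′≢y (sym y≡y′)
    z∉X : lookup X z ≡ false
    z∉X with lookup X z in z∈X
    ... | false = refl
    ... | true with X⇒ z z∈X
    ...   | inj₁ refl = ⊥-elim (f≢eᵤ (unique u f∈M eᵤ∈M (joins⇒incidentʳ G f-y′z) (joins⇒incidentˡ G eᵤ-uy)))
    ...   | inj₂ (inj₁ refl) = ⊥-elim (f≢eᵤ (unique y f∈M eᵤ∈M (joins⇒incidentʳ G f-y′z) (joins⇒incidentʳ G eᵤ-uy)))
    ...   | inj₂ (inj₂ refl) = ⊥-elim (loopless-joins G loopless f-y′z)
    hf≡1 : h f ≡ 1
    hf≡1 rewrite f∈M | crosses-joins G f-y′z X | ⇒X y′ (inj₂ (inj₂ refl)) | z∉X = refl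
    entering-is-eᵤ : ∀ {e x} → lookup M e ≡ true → e ≢ f → Incident G e x → lookup X x ≡ true → e ≡ eᵤ
    entering-is-eᵤ {x = x} e∈M e≢f e∋x x∈X with X⇒ x x∈X
    ... | inj₁ refl = unique u e∈M eᵤ∈M e∋x (joins⇒incidentˡ G eᵤ-uy)
    ... | inj₂ (inj₁ refl) = unique y e∈M eᵤ∈M e∋x (joins⇒incidentʳ G eᵤ-uy)
    ... | inj₂ (inj₂ refl) = ⊥-elim (e≢f (unique y′ e∈M f∈M e∋x f∋y′))
    eᵤ-inside : crosses G X eᵤ ≡ false
    eᵤ-inside rewrite crosses-joins G eᵤ-uy X | ⇒X u (inj₁ refl) | ⇒X y (inj₂ (inj₁ refl)) = refl
    h≡0 : ∀ e → e ≢ f → h e ≡ 0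
    h≡0 e e≢f with lookup M e in e∈M
    ... | false = refl
    ... | true with lookup X (endA G e) in a∈X | lookup X (endB G e) in b∈X
    ...   | true | true = refl
    ...   | false | false = refl
    ...   | true | false with entering-is-eᵤ e∈M e≢f (inj₁ refl) a∈X
    ...     | refl with trans (sym (cong₂ _xor_ a∈X b∈X)) eᵤ-inside
    ...       | ()
    h≡0 e e≢f | true | false | true with entering-is-eᵤ e∈M e≢f (inj₂ refl) b∈X
    ...     | refl with trans (sym (cong₂ _xor_ a∈X b∈X)) eᵤ-inside
    ...       | ()

  adjacent-≢ : ∀ {u v} → Adjacent G u v → v ≢ u
  adjacent-≢ (e , j) refl = loopless-joins G loopless j

  triple-tight : ∀ {u a c} → Adjacent G u a → Adjacent G u c → a ≢ c → (∀ v → Adjacent G u v → v ≡ a ⊎ v ≡ c) →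
    TightCut G (triple u a c)
  triple-tight {u} {a} {c} u~a u~c a≢c N⊆ac M pm with matched-edge-at pm u
  ... | eᵤ , eᵤ∈M , eᵤ∋u with incident⇒joins G eᵤ∋u
  ...   | z , eᵤ-uz with N⊆ac z (eᵤ , eᵤ-uz)
  ...     | inj₁ refl = cutIn-triple (triple u a c) pm eᵤ∈M eᵤ-uz (adjacent-≢ u~c) (a≢c ∘ sym)
                          (λ _ → ∈triple⇒ u a c) (λ _ → ⇒∈triple u a c)
  ...     | inj₂ refl = cutIn-triple (triple u a c) pm eᵤ∈M eᵤ-uz (adjacent-≢ u~a) a≢c
                          (λ _ → swap ∘ ∈triple⇒ u a c) (λ _ → ⇒∈triple u a c ∘ swap)
    where
    swap : ∀ {v p q} → v ≡ u ⊎ v ≡ p ⊎ v ≡ q → v ≡ u ⊎ v ≡ q ⊎ v ≡ p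
    swap (inj₁ x) = inj₁ x
    swap (inj₂ (inj₁ x)) = inj₂ (inj₂ x)
    swap (inj₂ (inj₂ x)) = inj₂ (inj₁ x)

  module _ (brick : Brick G) where
    private
      connected : Connected G
      connected = proj₁ (proj₁ (proj₂ brick))

      covered : ∀ e → ∃ λ M → IsPM G M × lookup M e ≡ true
      covered e with proj₂ (proj₂ (proj₁ (proj₂ brick))) e
      ... | M , pm , e∈M = M , pm , []=⇒lookup e∈M

    neighbours-not-⊆-single : ∀ u a → (∀ v → Adjacent G u v → v ≡ a) → ⊥
    neighbours-not-⊆-single u a N⊆a with 3 ≤? n G
    ... | yes 3≤n = large (third-element 3≤n u a)
      where
      P : Fin (n G) → Set
      P v = v ≡ u ⊎ v ≡ a
      leaves : ∀ {e x y} → Joins G e x y → P x → ¬ P y → ⊥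
      leaves j (inj₁ refl) ¬Py = ¬Py (inj₂ (N⊆a _ (_ , j)))
      leaves {e} {x} {y} j (inj₂ refl) ¬Py with covered e
      ... | M , pm , e∈M with matched-edge-at pm u
      ...   | eᵤ , eᵤ∈M , eᵤ∋u with incident⇒joins G eᵤ∋u
      ...     | z , eᵤ-uz with N⊆a z (eᵤ , eᵤ-uz)
      ...       | refl with matched-edge-unique G pm x (λ ()) e∈M eᵤ∈M (joins⇒incidentˡ G j) (joins⇒incidentʳ G eᵤ-uz)
      ...         | refl with incident⇒end G eᵤ-uz (joins⇒incidentʳ G j)
      ...           | inj₁ u≡y = ¬Py (inj₁ (sym u≡y))
      ...           | inj₂ z≡y = ¬Py (inj₂ (sym z≡y))
      large : (∃ λ w → w ≢ u × w ≢ a) → ⊥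
      large (w , w≢u , w≢a) with exit-edge P (λ v → (v ≟ u) ⊎-dec (v ≟ a)) (connected u w) (inj₁ refl) [ w≢u , w≢a ]
      ... | _ , _ , _ , j , Px , ¬Py = leaves j Px ¬Py
    ... | no 3≰n = proj₁ brick (colour , proper)
      where
      colour : Fin (n G) → Bool
      colour v = does (v ≟ u)
      proper : ∀ e → colour (endA G e) ≢ colour (endB G e)
      proper e with endA G e ≟ u | endB G e ≟ u
      ... | yes p | yes q = λ _ → loopless e (trans p (sym q))
      ... | yes _ | no _ = λ ()
      ... | no _ | yes _ = λ ()
      ... | no p | no q = λ _ → no-three-distinct (≤-pred (≰⇒> 3≰n)) (loopless e) p q

    neighbours-not-⊆-pair : ∀ {M₀} u a c → IsPMMinus G (ClosedNbhd G u) M₀ → Adjacent G u a → Adjacent G u c → a ≢ c →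
      (∀ v → Adjacent G u v → v ≡ a ⊎ v ≡ c) → ⊥
    neighbours-not-⊆-pair u a c M₀-pm u~a u~c a≢c N⊆ac = [ singleton , co-singleton ] (proj₂ (proj₂ brick) X (triple-tight u~a u~c a≢c N⊆ac))
      where
      X : Subset (n G)
      X = triple u a c
      X⇒ : ∀ {v} → lookup X v ≡ true → v ≡ u ⊎ v ≡ a ⊎ v ≡ c
      X⇒ = ∈triple⇒ u a c
      ⇒X : ∀ {v} → v ≡ u ⊎ v ≡ a ⊎ v ≡ c → lookup X v ≡ true
      ⇒X = ⇒∈triple u a c
      singleton : ∣ X ∣ ≡ 1 → ⊥
      singleton ∣X∣≡1 = adjacent-≢ u~a (sym (sum≡1-unique (χ X) (trans (sym (∣∣-sum X)) ∣X∣≡1)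
        (subst (λ b → bit b ≢ 0) (sym (⇒X (inj₁ refl))) λ ())
        (subst (λ b → bit b ≢ 0) (sym (⇒X (inj₂ (inj₁ refl)))) λ ())))
      outside⇒∉N[u] : ∀ {v} → lookup X v ≡ false → ¬ ClosedNbhd G u v
      outside⇒∉N[u] v∉X (inj₁ refl) = contradiction (trans (sym v∉X) (⇒X (inj₁ refl))) λ ()
      outside⇒∉N[u] v∉X (inj₂ u~v) = contradiction (trans (sym v∉X) (⇒X (inj₂ (N⊆ac _ u~v)))) λ ()
      ∉N[u]⇒outside : ∀ {v} → ¬ ClosedNbhd G u v → lookup X v ≡ false
      ∉N[u]⇒outside {v} v∉N[u] with lookup X v in v∈X
      ... | false = refl
      ... | true with X⇒ v∈X
      ...   | inj₁ refl = ⊥-elim (v∉N[u] (inj₁ refl))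
      ...   | inj₂ (inj₁ refl) = ⊥-elim (v∉N[u] (inj₂ u~a))
      ...   | inj₂ (inj₂ refl) = ⊥-elim (v∉N[u] (inj₂ u~c))
      co-singleton : ∣ ∁ X ∣ ≡ 1 → ⊥
      co-singleton ∣∁X∣≡1 with sum≡1⇒ (λ v → bit (not (lookup X v))) (trans (sym (∣∁∣-sum X)) ∣∁X∣≡1)
      ... | w , w∉X , only-w = lone-vertex-unmatchable M₀-pm w (outside⇒∉N[u] (Bool.not-injective (bit≡1⇒ w∉X))) only
        where
        only : ∀ {v} → ¬ ClosedNbhd G u v → v ≡ w
        only {v} v∉N[u] with v ≟ w
        ... | yes v≡w = v≡w
        ... | no v≢w = contradiction (only-w v v≢w) (subst (λ b → bit (not b) ≢ 0) (sym (∉N[u]⇒outside v∉N[u])) λ ())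

-- Matchings at a triangle

-- a perfect matching at the corners of a triangle b₁b₂b₃ with pendant edges xᵢ at bᵢ (tᵢⱼ joins bᵢ and bⱼ)
triangle-bits : ∀ x₁ x₂ x₃ t₁₂ t₂₃ t₁₃ →
  bit x₁ + bit t₁₂ + bit t₁₃ ≡ 1 → bit x₂ + bit t₁₂ + bit t₂₃ ≡ 1 → bit x₃ + bit t₂₃ + bit t₁₃ ≡ 1 →
  (x₁ ≡ true × x₂ ≡ true × x₃ ≡ true × t₁₂ ≡ false × t₂₃ ≡ false × t₁₃ ≡ false)
  ⊎ (t₂₃ ≡ x₁ × t₁₃ ≡ x₂ × t₁₂ ≡ x₃ × bit x₁ + bit x₂ + bit x₃ ≡ 1)
triangle-bits x₁ x₂ x₃ t₁₂ t₂₃ t₁₃ h₁ h₂ h₃ with one₃ x₁ t₁₂ t₁₃ h₁ | one₃ x₂ t₁₂ t₂₃ h₂ | one₃ x₃ t₂₃ t₁₃ h₃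
... | first | first | first = inj₁ (refl , refl , refl , refl , refl , refl)
... | second | second | first = inj₂ (refl , refl , refl , refl)
... | first | third | second = inj₂ (refl , refl , refl , refl)
... | third | first | third = inj₂ (refl , refl , refl , refl)

merge-bits : ∀ R p q → R + bit p + bit q ≡ 1 → R + bit (p xor q) ≡ 1
merge-bits R true true h = contradiction (suc-injective (trans (two+ R) h)) λ ()
  where
  two+ : ∀ R → suc (suc R) ≡ R + 1 + 1
  two+ = solve-∀
merge-bits R true false h = trans (sym (+-identityʳ (R + 1))) h
merge-bits R false true h = trans (cong (_+ 1) (sym (+-identityʳ R))) h
merge-bits R false false h = trans (sym (+-identityʳ (R + 0))) h

-- mᵢ: a lifted perfect matching uses the pendant edge bᵢaᵢ and the triangle edge opposite bᵢ;
-- xᵢ, yᵢ: the sides of bᵢ and aᵢ. Together the two edges cross like uaᵢ crosses the contracted cut.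
parity-transfer : ∀ R {m₁ m₂ m₃} x₁ x₂ x₃ y₁ y₂ y₃ → One₃ m₁ m₂ m₃ →
  R + bit m₁ * bit (x₁ xor y₁) + bit m₂ * bit (x₂ xor y₂) + bit m₃ * bit (x₃ xor y₃)
    + (bit m₃ * bit (x₁ xor x₂) + (bit m₁ * bit (x₂ xor x₃) + (bit m₂ * bit (x₁ xor x₃) + 0))) ≡ 1 →
  R + bit m₁ * bit (((x₁ xor x₂) xor x₃) xor y₁) + bit m₂ * bit (((x₁ xor x₂) xor x₃) xor y₂)
    + bit m₃ * bit (((x₁ xor x₂) xor x₃) xor y₃) ≡ 1
parity-transfer R x₁ x₂ x₃ y₁ y₂ y₃ first h =
  trans (shape₁ R _) (subst (λ b → R + bit b ≡ 1) (parity₁ x₁ x₂ x₃ y₁) (merge-bits R _ _ (trans (sym (pick₁ R _ _)) h)))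
  where
  shape₁ : ∀ R k → R + (k + 0) + 0 + 0 ≡ R + k
  shape₁ = solve-∀
  pick₁ : ∀ R a b → R + (a + 0) + 0 + 0 + (0 + ((b + 0) + (0 + 0))) ≡ R + a + b
  pick₁ = solve-∀
  parity₁ : ∀ x₁ x₂ x₃ y → (x₁ xor y) xor (x₂ xor x₃) ≡ ((x₁ xor x₂) xor x₃) xor y
  parity₁ = solve-xor 4 (λ x₁ x₂ x₃ y → (x₁ ⊕ y) ⊕ (x₂ ⊕ x₃) ⊜ ((x₁ ⊕ x₂) ⊕ x₃) ⊕ y) refl
parity-transfer R x₁ x₂ x₃ y₁ y₂ y₃ second h =
  trans (shape₂ R _) (subst (λ b → R + bit b ≡ 1) (parity₂ x₁ x₂ x₃ y₂) (merge-bits R _ _ (trans (sym (pick₂ R _ _)) h)))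
  where
  shape₂ : ∀ R k → R + 0 + (k + 0) + 0 ≡ R + k
  shape₂ = solve-∀
  pick₂ : ∀ R a b → R + 0 + (a + 0) + 0 + (0 + (0 + ((b + 0) + 0))) ≡ R + a + b
  pick₂ = solve-∀
  parity₂ : ∀ x₁ x₂ x₃ y → (x₂ xor y) xor (x₁ xor x₃) ≡ ((x₁ xor x₂) xor x₃) xor y
  parity₂ = solve-xor 4 (λ x₁ x₂ x₃ y → (x₂ ⊕ y) ⊕ (x₁ ⊕ x₃) ⊜ ((x₁ ⊕ x₂) ⊕ x₃) ⊕ y) refl
parity-transfer R x₁ x₂ x₃ y₁ y₂ y₃ third h =
  trans (shape₃ R _) (subst (λ b → R + bit b ≡ 1) (parity₃ x₁ x₂ x₃ y₃) (merge-bits R _ _ (trans (sym (pick₃ R _ _)) h)))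
  where
  shape₃ : ∀ R k → R + 0 + 0 + (k + 0) ≡ R + k
  shape₃ = solve-∀
  pick₃ : ∀ R a b → R + 0 + 0 + (a + 0) + ((b + 0) + (0 + (0 + 0))) ≡ R + a + b
  pick₃ = solve-∀
  parity₃ : ∀ x₁ x₂ x₃ y → (x₃ xor y) xor (x₁ xor x₂) ≡ ((x₁ xor x₂) xor x₃) xor y
  parity₃ = solve-xor 4 (λ x₁ x₂ x₃ y → (x₃ ⊕ y) ⊕ (x₁ ⊕ x₂) ⊜ ((x₁ ⊕ x₂) ⊕ x₃) ⊕ y) refl

-- Triangle insertion

unique-member : ∀ {G S} → NumPMMinus G S 1 → ∃ λ M₀ → IsPMMinus G S M₀ × (∀ M → IsPMMinus G S M → M ≡ M₀)
unique-member (M₀ ∷ [] , _ , _ , M∈⇔pm) =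
  M₀ , Equivalence.to (M∈⇔pm M₀) (here refl) , λ M pm → only (Equivalence.from (M∈⇔pm M) pm)
  where
  only : ∀ {M} → M List.∈ (M₀ ∷ []) → M ≡ M₀
  only (here M≡M₀) = M≡M₀

excess-grows : ∀ k N E → k + N ≡ E + 1 → suc k + (N + 2) ≡ E + 3 + 1
excess-grows k N E k+N≡E+1 = trans (shift k N) (trans (cong (_+ 3) k+N≡E+1) (swap E))
  where
  shift : ∀ k N → suc k + (N + 2) ≡ k + N + 3
  shift = solve-∀
  swap : ∀ E → E + 1 + 3 ≡ E + 3 + 1
  swap = solve-∀

module Insertion (G : Graph) (loopless : Loopless G) (u : Fin (n G)) (deg-u : deg G u ≡ 3)
  (e₁ e₂ e₃ : Fin (m G)) (e₁≢e₂ : e₁ ≢ e₂) (e₁≢e₃ : e₁ ≢ e₃) (e₂≢e₃ : e₂ ≢ e₃)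
  (e₁∋u : Incident G e₁ u) (e₂∋u : Incident G e₂ u) (e₃∋u : Incident G e₃ u) where

  N E : ℕ
  N = n G
  E = m G

  rest : (Fin E → ℕ) → ℕ
  rest g = sum (erase₃ e₁ e₂ e₃ g)

  sum-at-u : ∀ g → sum g ≡ rest g + g e₁ + g e₂ + g e₃
  sum-at-u = sum-erase₃ e₁ e₂ e₃ e₁≢e₂ e₁≢e₃ e₂≢e₃

  rest-cong : ∀ g h → (∀ e → e ≢ e₁ → e ≢ e₂ → e ≢ e₃ → g e ≡ h e) → rest g ≡ rest h
  rest-cong = sum-erase₃-cong e₁ e₂ e₃

  rest-zero : ∀ g → (∀ e → e ≢ e₁ → e ≢ e₂ → e ≢ e₃ → g e ≡ 0) → rest g ≡ 0
  rest-zero g g≡0 = trans (rest-cong g (λ _ → 0) g≡0) (sum-zero _ (λ e → erase₃-zero e))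
    where
    erase₃-zero : ∀ e → erase₃ e₁ e₂ e₃ (λ _ → 0) e ≡ 0
    erase₃-zero e with e ≟ e₃
    ... | yes _ = refl
    ... | no _ with e ≟ e₂
    ...   | yes _ = refl
    ...   | no _ with e ≟ e₁
    ...     | yes _ = refl
    ...     | no _ = refl

  -- As deg u = 3, the three edges at u leave nothing for the others.
  ¬incident-elsewhere : ∀ {e} → e ≢ e₁ → e ≢ e₂ → e ≢ e₃ → ¬ Incident G e u
  ¬incident-elsewhere {e} e≢e₁ e≢e₂ e≢e₃ e∋u = contradiction
    (trans (sym (erase₃-elsewhere e₁ e₂ e₃ 𝟙u e≢e₁ e≢e₂ e≢e₃)) (sum≡0⇒ _ rest≡0 e))
    (subst (_≢ 0) (sym (𝟙-yes (incident? G e u) e∋u)) λ ())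
    where
    𝟙u : Fin E → ℕ
    𝟙u f = 𝟙 (incident? G f u)
    rest≡0 : rest 𝟙u ≡ 0
    rest≡0 = +-cancelʳ-≡ 3 (rest 𝟙u) 0 (begin
      rest 𝟙u + 3                                  ≡⟨ three-ones (rest 𝟙u) ⟩
      rest 𝟙u + 1 + 1 + 1                          ≡⟨ cong₂ (λ x y → rest 𝟙u + x + y + _) (𝟙-yes _ e₁∋u) (𝟙-yes _ e₂∋u) ⟨
      rest 𝟙u + 𝟙u e₁ + 𝟙u e₂ + 1                  ≡⟨ cong (rest 𝟙u + 𝟙u e₁ + 𝟙u e₂ +_) (𝟙-yes _ e₃∋u) ⟨
      rest 𝟙u + 𝟙u e₁ + 𝟙u e₂ + 𝟙u e₃              ≡⟨ sum-at-u 𝟙u ⟨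
      sum 𝟙u                                       ≡⟨ trans (sym (deg-sum G u)) deg-u ⟩
      3                                            ∎)
      where
      open ≡-Reasoning
      three-ones : ∀ x → x + 3 ≡ x + 1 + 1 + 1
      three-ones = solve-∀

  a₁ a₂ a₃ : Fin N
  a₁ = proj₁ (incident⇒joins G e₁∋u)
  a₂ = proj₁ (incident⇒joins G e₂∋u)
  a₃ = proj₁ (incident⇒joins G e₃∋u)

  e₁-ua₁ : Joins G e₁ u a₁
  e₁-ua₁ = proj₂ (incident⇒joins G e₁∋u)
  e₂-ua₂ : Joins G e₂ u a₂
  e₂-ua₂ = proj₂ (incident⇒joins G e₂∋u)
  e₃-ua₃ : Joins G e₃ u a₃
  e₃-ua₃ = proj₂ (incident⇒joins G e₃∋u)

  far-end-≢u : ∀ {e a} → Joins G e u a → a ≢ u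
  far-end-≢u j refl = loopless-joins G loopless j

  u~a₁ : Adjacent G u a₁
  u~a₁ = e₁ , e₁-ua₁
  u~a₂ : Adjacent G u a₂
  u~a₂ = e₂ , e₂-ua₂
  u~a₃ : Adjacent G u a₃
  u~a₃ = e₃ , e₃-ua₃

  neighbour-of-u : ∀ {v} → Adjacent G u v → v ≡ a₁ ⊎ v ≡ a₂ ⊎ v ≡ a₃
  neighbour-of-u (e , j) with among₃ e₁ e₂ e₃ e
  ... | at₁ = inj₁ (joins-far-end G loopless e₁-ua₁ j)
  ... | at₂ = inj₂ (inj₁ (joins-far-end G loopless e₂-ua₂ j))
  ... | at₃ = inj₂ (inj₂ (joins-far-end G loopless e₃-ua₃ j))
  ... | elsewhere e≢e₁ e≢e₂ e≢e₃ = ⊥-elim (¬incident-elsewhere e≢e₁ e≢e₂ e≢e₃ (joins⇒incidentˡ G j))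

  at-u? : Fin E → Bool
  at-u? e = does (e ≟ e₁) ∨ does (e ≟ e₂) ∨ does (e ≟ e₃)

  at-u?-elsewhere : ∀ {e} → e ≢ e₁ → e ≢ e₂ → e ≢ e₃ → at-u? e ≡ false
  at-u?-elsewhere {e} p q r with e ≟ e₁ | e ≟ e₂ | e ≟ e₃
  ... | yes e≡e₁ | _ | _ = ⊥-elim (p e≡e₁)
  ... | no _ | yes e≡e₂ | _ = ⊥-elim (q e≡e₂)
  ... | no _ | no _ | yes e≡e₃ = ⊥-elim (r e≡e₃)
  ... | no _ | no _ | no _ = refl

  at-u?-incident : ∀ {e} → Incident G e u → at-u? e ≡ true
  at-u?-incident {e} e∋u with e ≟ e₁ | e ≟ e₂ | e ≟ e₃
  ... | yes _ | _ | _ = refl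
  ... | no _ | yes _ | _ = refl
  ... | no _ | no _ | yes _ = refl
  ... | no p | no q | no r = ⊥-elim (¬incident-elsewhere p q r e∋u)

  ∉N[u] : ∀ {v} → v ≢ u → v ≢ a₁ → v ≢ a₂ → v ≢ a₃ → ¬ ClosedNbhd G u v
  ∉N[u] v≢u _ _ _ (inj₁ v≡u) = v≢u v≡u
  ∉N[u] _ v≢a₁ v≢a₂ v≢a₃ (inj₂ u~v) = [ v≢a₁ , [ v≢a₂ , v≢a₃ ] ] (neighbour-of-u u~v)

  𝟙-incident-far : ∀ {e a} → Joins G e u a → ∀ {v} → v ≢ u → 𝟙 (incident? G e v) ≡ 𝟙 (a ≟ v)
  𝟙-incident-far j {v} v≢u = trans (𝟙-incident G j v) (𝟙-cong _ _ far inj₂)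
    where
    far : ∀ {a} → u ≡ v ⊎ a ≡ v → a ≡ v
    far (inj₁ u≡v) = ⊥-elim (v≢u (sym u≡v))
    far (inj₂ a≡v) = a≡v

  degIn-u : ∀ M → degIn G M u ≡ χ M e₁ + χ M e₂ + χ M e₃
  degIn-u M = begin
    degIn G M u                                       ≡⟨ degIn-sum G M u ⟩
    sum g                                             ≡⟨ sum-at-u g ⟩
    rest g + g e₁ + g e₂ + g e₃                       ≡⟨ cong (λ x → x + g e₁ + g e₂ + g e₃) rest≡0 ⟩
    g e₁ + g e₂ + g e₃                                ≡⟨ cong₂ (λ x y → x + y + g e₃) (g-at e₁∋u) (g-at e₂∋u) ⟩
    χ M e₁ + χ M e₂ + g e₃                            ≡⟨ cong (χ M e₁ + χ M e₂ +_) (g-at e₃∋u) ⟩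
    χ M e₁ + χ M e₂ + χ M e₃                          ∎
    where
    open ≡-Reasoning
    g : Fin E → ℕ
    g e = χ M e * 𝟙 (incident? G e u)
    rest≡0 : rest g ≡ 0
    rest≡0 = rest-zero g λ e p q r → trans (cong (χ M e *_) (𝟙-no _ (¬incident-elsewhere p q r))) (*-zeroʳ (χ M e))
    g-at : ∀ {e} → Incident G e u → g e ≡ χ M e
    g-at {e} e∋u = trans (cong (χ M e *_) (𝟙-yes _ e∋u)) (*-identityʳ _)

  pm-at-u : ∀ {M} → IsPM G M → χ M e₁ + χ M e₂ + χ M e₃ ≡ 1
  pm-at-u {M} pm = trans (sym (degIn-u M)) (proj₂ pm u λ ())

  neighbours-distinct : Brick G → ∀ {M₀} → IsPMMinus G (ClosedNbhd G u) M₀ → a₁ ≢ a₂ × a₁ ≢ a₃ × a₂ ≢ a₃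
  neighbours-distinct brick M₀-pm =
    distinct u~a₁ u~a₃ neighbour-of-u ,
    distinct u~a₁ u~a₂ ([ inj₁ , [ inj₂ ∘ inj₂ , inj₂ ∘ inj₁ ] ] ∘ neighbour-of-u) ,
    distinct u~a₂ u~a₁ ([ inj₂ ∘ inj₂ , [ inj₁ , inj₂ ∘ inj₁ ] ] ∘ neighbour-of-u)
    where
    distinct : ∀ {p q r} → Adjacent G u p → Adjacent G u r → (∀ {v} → Adjacent G u v → v ≡ p ⊎ v ≡ q ⊎ v ≡ r) → p ≢ q
    distinct {p} {_} {r} u~p u~r N⊆pqr refl with p ≟ r
    ... | yes refl = neighbours-not-⊆-single G loopless brick u p λ _ u~v → [ id , [ id , id ] ] (N⊆pqr u~v)
    ... | no p≢r = neighbours-not-⊆-pair G loopless brick u p r M₀-pm u~p u~r p≢r λ _ u~v → [ inj₁ , [ inj₁ , inj₂ ] ] (N⊆pqr u~v)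

  H : Graph
  H = triangleInsert G u e₂ e₃

  old : Fin N → Fin (N + 2)
  old v = v ↑ˡ 2

  b₁ b₂ b₃ : Fin (N + 2)
  b₁ = old u
  b₂ = N ↑ʳ zero
  b₃ = N ↑ʳ suc zero

  old-edge : Fin E → Fin (E + 3)
  old-edge e = e ↑ˡ 3

  t₁₂ t₂₃ t₁₃ : Fin (E + 3)
  t₁₂ = E ↑ʳ zero
  t₂₃ = E ↑ʳ suc zero
  t₁₃ = E ↑ʳ suc (suc zero)

  data VertexOfH : Fin (N + 2) → Set where
    old-vertex : ∀ v → VertexOfH (old v)
    new-b₂ : VertexOfH b₂
    new-b₃ : VertexOfH b₃

  vertex-view : ∀ w → VertexOfH w
  vertex-view w with splitAt N w | join-splitAt N 2 w
  ... | inj₁ v | refl = old-vertex v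
  ... | inj₂ zero | refl = new-b₂
  ... | inj₂ (suc zero) | refl = new-b₃

  data EdgeOfH : Fin (E + 3) → Set where
    old-edge-of : ∀ e → EdgeOfH (old-edge e)
    new-t₁₂ : EdgeOfH t₁₂
    new-t₂₃ : EdgeOfH t₂₃
    new-t₁₃ : EdgeOfH t₁₃

  edge-view : ∀ f → EdgeOfH f
  edge-view f with splitAt E f | join-splitAt E 3 f
  ... | inj₁ e | refl = old-edge-of e
  ... | inj₂ zero | refl = new-t₁₂
  ... | inj₂ (suc zero) | refl = new-t₂₃
  ... | inj₂ (suc (suc zero)) | refl = new-t₁₃

  old-injective : ∀ {v w} → old v ≡ old w → v ≡ w
  old-injective {v} {w} = ↑ˡ-injective 2 v w

  old≢b₂ : ∀ {v} → old v ≢ b₂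
  old≢b₂ {v} = ↑ˡ≢↑ʳ v zero

  old≢b₃ : ∀ {v} → old v ≢ b₃
  old≢b₃ {v} = ↑ˡ≢↑ʳ v (suc zero)

  b₂≢b₃ : b₂ ≢ b₃
  b₂≢b₃ p with ↑ʳ-injective N zero (suc zero) p
  ... | ()

  -- the copy of u that an edge at u is attached to in H
  attachment : Fin E → Fin (N + 2)
  attachment e with e ≟ e₂ | e ≟ e₃
  ... | yes _ | _ = b₂
  ... | no _ | yes _ = b₃
  ... | no _ | no _ = b₁

  endA-away : ∀ e → endA G e ≢ u → endA H (old-edge e) ≡ old (endA G e)
  endA-away e ≢u rewrite splitAt-↑ˡ E e 3 with endA G e ≟ u | e ≟ e₂ | e ≟ e₃
  ... | yes ≡u | _ | _ = ⊥-elim (≢u ≡u)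
  ... | no _ | _ | _ = refl

  endB-away : ∀ e → endB G e ≢ u → endB H (old-edge e) ≡ old (endB G e)
  endB-away e ≢u rewrite splitAt-↑ˡ E e 3 with endB G e ≟ u | e ≟ e₂ | e ≟ e₃
  ... | yes ≡u | _ | _ = ⊥-elim (≢u ≡u)
  ... | no _ | _ | _ = refl

  endA-at-u : ∀ e → endA G e ≡ u → endA H (old-edge e) ≡ attachment e
  endA-at-u e ≡u rewrite splitAt-↑ˡ E e 3 with endA G e ≟ u | e ≟ e₂ | e ≟ e₃
  ... | no ≢u | _ | _ = ⊥-elim (≢u ≡u)
  ... | yes _ | yes _ | _ = refl
  ... | yes _ | no _ | yes _ = refl
  ... | yes refl | no _ | no _ = refl

  endB-at-u : ∀ e → endB G e ≡ u → endB H (old-edge e) ≡ attachment e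
  endB-at-u e ≡u rewrite splitAt-↑ˡ E e 3 with endB G e ≟ u | e ≟ e₂ | e ≟ e₃
  ... | no ≢u | _ | _ = ⊥-elim (≢u ≡u)
  ... | yes _ | yes _ | _ = refl
  ... | yes _ | no _ | yes _ = refl
  ... | yes refl | no _ | no _ = refl

  joins-away : ∀ {e} → e ≢ e₁ → e ≢ e₂ → e ≢ e₃ → Joins H (old-edge e) (old (endA G e)) (old (endB G e))
  joins-away {e} p q r = inj₁ (endA-away e (¬incident-elsewhere p q r ∘ inj₁) , endB-away e (¬incident-elsewhere p q r ∘ inj₂))

  incident-away : ∀ {e x} → e ≢ e₁ → e ≢ e₂ → e ≢ e₃ → Incident G e x → Incident H (old-edge e) (old x)
  incident-away p q r (inj₁ refl) = joins⇒incidentˡ H (joins-away p q r)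
  incident-away p q r (inj₂ refl) = joins⇒incidentʳ H (joins-away p q r)

  joins-at-u : ∀ {e a} → Joins G e u a → Joins H (old-edge e) (attachment e) (old a)
  joins-at-u {e} (inj₁ (≡u , refl)) = inj₁ (endA-at-u e ≡u , endB-away e (λ p → loopless e (trans ≡u (sym p))))
  joins-at-u {e} (inj₂ (refl , ≡u)) = inj₂ (endA-away e (λ p → loopless e (trans p (sym ≡u))) , endB-at-u e ≡u)

  e₁-b₁a₁ : Joins H (old-edge e₁) b₁ (old a₁)
  e₁-b₁a₁ = subst (λ b → Joins H (old-edge e₁) b (old a₁)) attached (joins-at-u e₁-ua₁)
    where
    attached : attachment e₁ ≡ b₁
    attached with e₁ ≟ e₂ | e₁ ≟ e₃
    ... | yes p | _ = ⊥-elim (e₁≢e₂ p)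
    ... | no _ | yes p = ⊥-elim (e₁≢e₃ p)
    ... | no _ | no _ = refl

  e₂-b₂a₂ : Joins H (old-edge e₂) b₂ (old a₂)
  e₂-b₂a₂ = subst (λ b → Joins H (old-edge e₂) b (old a₂)) attached (joins-at-u e₂-ua₂)
    where
    attached : attachment e₂ ≡ b₂
    attached with e₂ ≟ e₂
    ... | yes _ = refl
    ... | no p = ⊥-elim (p refl)

  e₃-b₃a₃ : Joins H (old-edge e₃) b₃ (old a₃)
  e₃-b₃a₃ = subst (λ b → Joins H (old-edge e₃) b (old a₃)) attached (joins-at-u e₃-ua₃)
    where
    attached : attachment e₃ ≡ b₃
    attached with e₃ ≟ e₂ | e₃ ≟ e₃
    ... | yes p | _ = ⊥-elim (e₂≢e₃ (sym p))
    ... | no _ | yes _ = refl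
    ... | no _ | no p = ⊥-elim (p refl)

  t₁₂-b₁b₂ : Joins H t₁₂ b₁ b₂
  t₁₂-b₁b₂ rewrite splitAt-↑ʳ E 3 zero = inj₁ (refl , refl)
  t₂₃-b₂b₃ : Joins H t₂₃ b₂ b₃
  t₂₃-b₂b₃ rewrite splitAt-↑ʳ E 3 (suc zero) = inj₁ (refl , refl)
  t₁₃-b₁b₃ : Joins H t₁₃ b₁ b₃
  t₁₃-b₁b₃ rewrite splitAt-↑ʳ E 3 (suc (suc zero)) = inj₁ (refl , refl)

  private
    𝟙-transport : ∀ {e x y x′ v} → Joins G e x y → Joins H (old-edge e) x′ (old y) →
      (x′ ≡ old v → x ≡ v) → (x ≡ v → x′ ≡ old v) → 𝟙 (incident? H (old-edge e) (old v)) ≡ 𝟙 (incident? G e v)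
    𝟙-transport {v = v} jG jH to from = trans (𝟙-incident H jH (old v)) (trans (𝟙-cong _ _
      (λ where (inj₁ p) → inj₁ (to p) ; (inj₂ p) → inj₂ (old-injective p))
      (λ where (inj₁ p) → inj₁ (from p) ; (inj₂ p) → inj₂ (cong old p)))
      (sym (𝟙-incident G jG v)))

  𝟙-incident-old : ∀ {v} → v ≢ u → ∀ e → 𝟙 (incident? H (old-edge e) (old v)) ≡ 𝟙 (incident? G e v)
  𝟙-incident-old {v} v≢u e with among₃ e₁ e₂ e₃ e
  ... | at₁ = 𝟙-transport e₁-ua₁ e₁-b₁a₁ (λ p → ⊥-elim (v≢u (sym (old-injective p)))) (λ p → ⊥-elim (v≢u (sym p)))
  ... | at₂ = 𝟙-transport e₂-ua₂ e₂-b₂a₂ (λ p → ⊥-elim (old≢b₂ (sym p))) (λ p → ⊥-elim (v≢u (sym p)))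
  ... | at₃ = 𝟙-transport e₃-ua₃ e₃-b₃a₃ (λ p → ⊥-elim (old≢b₃ (sym p))) (λ p → ⊥-elim (v≢u (sym p)))
  ... | elsewhere p q r = 𝟙-transport (joins-ends G e) (joins-away p q r) old-injective (cong old)

  private
    far≢b₁ : ∀ {e a} → Joins G e u a → old a ≢ b₁
    far≢b₁ j p = far-end-≢u j (old-injective p)

    𝟙-incident-away : ∀ {e} → e ≢ e₁ → e ≢ e₂ → e ≢ e₃ → ∀ {b} → (∀ {x} → x ≢ u → old x ≢ b) →
      𝟙 (incident? H (old-edge e) b) ≡ 0
    𝟙-incident-away p q r ≢b =
      𝟙-incident-no H (joins-away p q r) (≢b (¬incident-elsewhere p q r ∘ inj₁)) (≢b (¬incident-elsewhere p q r ∘ inj₂))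

  𝟙-incident-b₁ : ∀ e → 𝟙 (incident? H (old-edge e) b₁) ≡ 𝟙 (e ≟ e₁)
  𝟙-incident-b₁ e with among₃ e₁ e₂ e₃ e
  ... | at₁ = trans (𝟙-yes _ (joins⇒incidentˡ H e₁-b₁a₁)) (sym (𝟙-yes _ refl))
  ... | at₂ = trans (𝟙-incident-no H e₂-b₂a₂ (old≢b₂ ∘ sym) (far≢b₁ e₂-ua₂)) (sym (𝟙-no _ (e₁≢e₂ ∘ sym)))
  ... | at₃ = trans (𝟙-incident-no H e₃-b₃a₃ (old≢b₃ ∘ sym) (far≢b₁ e₃-ua₃)) (sym (𝟙-no _ (e₁≢e₃ ∘ sym)))
  ... | elsewhere p q r = trans (𝟙-incident-away p q r λ x≢u → x≢u ∘ old-injective) (sym (𝟙-no _ p))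

  𝟙-incident-b₂ : ∀ e → 𝟙 (incident? H (old-edge e) b₂) ≡ 𝟙 (e ≟ e₂)
  𝟙-incident-b₂ e with among₃ e₁ e₂ e₃ e
  ... | at₁ = trans (𝟙-incident-no H e₁-b₁a₁ old≢b₂ old≢b₂) (sym (𝟙-no _ e₁≢e₂))
  ... | at₂ = trans (𝟙-yes _ (joins⇒incidentˡ H e₂-b₂a₂)) (sym (𝟙-yes _ refl))
  ... | at₃ = trans (𝟙-incident-no H e₃-b₃a₃ (b₂≢b₃ ∘ sym) old≢b₂) (sym (𝟙-no _ (e₂≢e₃ ∘ sym)))
  ... | elsewhere p q r = trans (𝟙-incident-away p q r λ _ → old≢b₂) (sym (𝟙-no _ q))

  𝟙-incident-b₃ : ∀ e → 𝟙 (incident? H (old-edge e) b₃) ≡ 𝟙 (e ≟ e₃)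
  𝟙-incident-b₃ e with among₃ e₁ e₂ e₃ e
  ... | at₁ = trans (𝟙-incident-no H e₁-b₁a₁ old≢b₃ old≢b₃) (sym (𝟙-no _ e₁≢e₃))
  ... | at₂ = trans (𝟙-incident-no H e₂-b₂a₂ b₂≢b₃ old≢b₃) (sym (𝟙-no _ e₂≢e₃))
  ... | at₃ = trans (𝟙-yes _ (joins⇒incidentˡ H e₃-b₃a₃)) (sym (𝟙-yes _ refl))
  ... | elsewhere p q r = trans (𝟙-incident-away p q r λ _ → old≢b₃) (sym (𝟙-no _ r))

  triangle-degIn : Subset (E + 3) → Fin (N + 2) → ℕ
  triangle-degIn S w = χ S t₁₂ * 𝟙 (incident? H t₁₂ w) + (χ S t₂₃ * 𝟙 (incident? H t₂₃ w) + (χ S t₁₃ * 𝟙 (incident? H t₁₃ w) + 0))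

  degIn-H : ∀ S w → degIn H S w ≡ sum (λ e → χ S (old-edge e) * 𝟙 (incident? H (old-edge e) w)) + triangle-degIn S w
  degIn-H S w = trans (degIn-sum H S w) (sum-++ E 3 _)

  triangle-degIn-at : ∀ S w {i j k} → 𝟙 (incident? H t₁₂ w) ≡ i → 𝟙 (incident? H t₂₃ w) ≡ j → 𝟙 (incident? H t₁₃ w) ≡ k →
    triangle-degIn S w ≡ χ S t₁₂ * i + (χ S t₂₃ * j + (χ S t₁₃ * k + 0))
  triangle-degIn-at S w p q r =
    cong₂ (λ x y → χ S t₁₂ * x + y) p (cong₂ (λ x y → χ S t₂₃ * x + y) q (cong (λ x → χ S t₁₃ * x + 0) r))

  degIn-H-old : ∀ S {v} → v ≢ u → degIn H S (old v) ≡ sum (λ e → χ S (old-edge e) * 𝟙 (incident? G e v))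
  degIn-H-old S {v} v≢u = begin
    degIn H S (old v)                                                                 ≡⟨ degIn-H S (old v) ⟩
    sum (λ e → χ S (old-edge e) * 𝟙 (incident? H (old-edge e) (old v))) + triangle-degIn S (old v)
      ≡⟨ cong₂ _+_ (sum-cong-≗ λ e → cong (χ S (old-edge e) *_) (𝟙-incident-old v≢u e)) triangle≡0 ⟩
    sum (λ e → χ S (old-edge e) * 𝟙 (incident? G e v)) + 0                          ≡⟨ +-identityʳ _ ⟩
    sum (λ e → χ S (old-edge e) * 𝟙 (incident? G e v))                              ∎
    where
    open ≡-Reasoning
    b₁≢old-v : b₁ ≢ old v
    b₁≢old-v p = v≢u (sym (old-injective p))
    zeros : ∀ x y z → x * 0 + (y * 0 + (z * 0 + 0)) ≡ 0
    zeros = solve-∀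
    triangle≡0 : triangle-degIn S (old v) ≡ 0
    triangle≡0 = trans (triangle-degIn-at S (old v)
      (𝟙-incident-no H t₁₂-b₁b₂ b₁≢old-v (old≢b₂ ∘ sym))
      (𝟙-incident-no H t₂₃-b₂b₃ (old≢b₂ ∘ sym) (old≢b₃ ∘ sym))
      (𝟙-incident-no H t₁₃-b₁b₃ b₁≢old-v (old≢b₃ ∘ sym))) (zeros (χ S t₁₂) (χ S t₂₃) (χ S t₁₃))

  private
    degIn-H-copy : ∀ S {b} eᵢ → (∀ e → 𝟙 (incident? H (old-edge e) b) ≡ 𝟙 (e ≟ eᵢ)) →
      degIn H S b ≡ χ S (old-edge eᵢ) + triangle-degIn S b
    degIn-H-copy S {b} eᵢ 𝟙-at-b = trans (degIn-H S b)
      (cong (_+ triangle-degIn S b) (trans (sum-cong-≗ λ e → cong (χ S (old-edge e) *_) (𝟙-at-b e)) (sum-δ (χ S ∘ old-edge) eᵢ)))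

    select₁₀₁ : ∀ w x y z → w + (x * 1 + (y * 0 + (z * 1 + 0))) ≡ w + x + z
    select₁₀₁ = solve-∀
    select₁₁₀ : ∀ w x y z → w + (x * 1 + (y * 1 + (z * 0 + 0))) ≡ w + x + y
    select₁₁₀ = solve-∀
    select₀₁₁ : ∀ w x y z → w + (x * 0 + (y * 1 + (z * 1 + 0))) ≡ w + y + z
    select₀₁₁ = solve-∀

  degIn-H-b₁ : ∀ S → degIn H S b₁ ≡ χ S (old-edge e₁) + χ S t₁₂ + χ S t₁₃
  degIn-H-b₁ S = trans (degIn-H-copy S e₁ 𝟙-incident-b₁) (trans (cong (χ S (old-edge e₁) +_) (triangle-degIn-at S b₁
    (𝟙-yes _ (joins⇒incidentˡ H t₁₂-b₁b₂))
    (𝟙-incident-no H t₂₃-b₂b₃ (old≢b₂ ∘ sym) (old≢b₃ ∘ sym))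
    (𝟙-yes _ (joins⇒incidentˡ H t₁₃-b₁b₃)))) (select₁₀₁ (χ S (old-edge e₁)) (χ S t₁₂) (χ S t₂₃) (χ S t₁₃)))

  degIn-H-b₂ : ∀ S → degIn H S b₂ ≡ χ S (old-edge e₂) + χ S t₁₂ + χ S t₂₃
  degIn-H-b₂ S = trans (degIn-H-copy S e₂ 𝟙-incident-b₂) (trans (cong (χ S (old-edge e₂) +_) (triangle-degIn-at S b₂
    (𝟙-yes _ (joins⇒incidentʳ H t₁₂-b₁b₂))
    (𝟙-yes _ (joins⇒incidentˡ H t₂₃-b₂b₃))
    (𝟙-incident-no H t₁₃-b₁b₃ old≢b₂ (b₂≢b₃ ∘ sym)))) (select₁₁₀ (χ S (old-edge e₂)) (χ S t₁₂) (χ S t₂₃) (χ S t₁₃)))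

  degIn-H-b₃ : ∀ S → degIn H S b₃ ≡ χ S (old-edge e₃) + χ S t₂₃ + χ S t₁₃
  degIn-H-b₃ S = trans (degIn-H-copy S e₃ 𝟙-incident-b₃) (trans (cong (χ S (old-edge e₃) +_) (triangle-degIn-at S b₃
    (𝟙-incident-no H t₁₂-b₁b₂ old≢b₃ b₂≢b₃)
    (𝟙-yes _ (joins⇒incidentʳ H t₂₃-b₂b₃))
    (𝟙-yes _ (joins⇒incidentʳ H t₁₃-b₁b₃)))) (select₀₁₁ (χ S (old-edge e₃)) (χ S t₁₂) (χ S t₂₃) (χ S t₁₃)))

  -- Perfect matchings of the inserted graph

  pm-H : ∀ {S} → (∀ {v} → v ≢ u → degIn H S (old v) ≡ 1) →
    degIn H S b₁ ≡ 1 → degIn H S b₂ ≡ 1 → degIn H S b₃ ≡ 1 → IsPM H S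
  pm-H {S} at-old at-b₁ at-b₂ at-b₃ = (λ _ _ → (λ ()) , (λ ())) , λ w _ → at (vertex-view w)
    where
    at : ∀ {w} → VertexOfH w → degIn H S w ≡ 1
    at (old-vertex v) with v ≟ u
    ... | yes refl = at-b₁
    ... | no v≢u = at-old v≢u
    at new-b₂ = at-b₂
    at new-b₃ = at-b₃

  -- t₂₃, t₁₃, t₁₂ are used exactly when e₁, e₂, e₃ are.
  lift : Subset E → Subset (E + 3)
  lift M = M ++ (lookup M e₃ ∷ lookup M e₁ ∷ lookup M e₂ ∷ [])

  lift-old : ∀ M e → lookup (lift M) (old-edge e) ≡ lookup M e
  lift-old M e = lookup-++ˡ M _ e

  lift-t₁₂ : ∀ M → lookup (lift M) t₁₂ ≡ lookup M e₃
  lift-t₁₂ M = lookup-++ʳ M _ zero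
  lift-t₂₃ : ∀ M → lookup (lift M) t₂₃ ≡ lookup M e₁
  lift-t₂₃ M = lookup-++ʳ M _ (suc zero)
  lift-t₁₃ : ∀ M → lookup (lift M) t₁₃ ≡ lookup M e₂
  lift-t₁₃ M = lookup-++ʳ M _ (suc (suc zero))

  lift-injective : ∀ {M M′} → lift M ≡ lift M′ → M ≡ M′
  lift-injective {M} {M′} = ++-injectiveˡ M M′

  lift-pm : ∀ {M} → IsPM G M → IsPM H (lift M)
  lift-pm {M} pm = pm-H at-old
    (at-copy (degIn-H-b₁ (lift M)) (lift-old M e₁) (lift-t₁₂ M) (lift-t₁₃ M) (acb (χ M e₁) (χ M e₂) (χ M e₃)))
    (at-copy (degIn-H-b₂ (lift M)) (lift-old M e₂) (lift-t₁₂ M) (lift-t₂₃ M) (bca (χ M e₁) (χ M e₂) (χ M e₃)))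
    (at-copy (degIn-H-b₃ (lift M)) (lift-old M e₃) (lift-t₂₃ M) (lift-t₁₃ M) (cab (χ M e₁) (χ M e₂) (χ M e₃)))
    where
    acb : ∀ a b c → a + c + b ≡ a + b + c
    acb = solve-∀
    bca : ∀ a b c → b + c + a ≡ a + b + c
    bca = solve-∀
    cab : ∀ a b c → c + a + b ≡ a + b + c
    cab = solve-∀
    at-copy : ∀ {b f g h x y z} → degIn H (lift M) b ≡ χ (lift M) f + χ (lift M) g + χ (lift M) h →
      lookup (lift M) f ≡ lookup M x → lookup (lift M) g ≡ lookup M y → lookup (lift M) h ≡ lookup M z →
      χ M x + χ M y + χ M z ≡ χ M e₁ + χ M e₂ + χ M e₃ → degIn H (lift M) b ≡ 1
    at-copy deg≡ f≡ g≡ h≡ reorder = trans deg≡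
      (trans (cong₂ _+_ (cong₂ _+_ (cong bit f≡) (cong bit g≡)) (cong bit h≡)) (trans reorder (pm-at-u pm)))
    at-old : ∀ {v} → v ≢ u → degIn H (lift M) (old v) ≡ 1
    at-old {v} v≢u = begin
      degIn H (lift M) (old v)                                      ≡⟨ degIn-H-old (lift M) v≢u ⟩
      sum (λ e → χ (lift M) (old-edge e) * 𝟙 (incident? G e v))    ≡⟨ sum-cong-≗ (λ e → cong (λ b → bit b * 𝟙 (incident? G e v)) (lift-old M e)) ⟩
      sum (λ e → χ M e * 𝟙 (incident? G e v))                       ≡⟨ degIn-sum G M v ⟨
      degIn G M v                                                   ≡⟨ proj₂ pm v (λ ()) ⟩
      1                                                             ∎
      where open ≡-Reasoning

  restrict : Subset (E + 3) → Subset E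
  restrict M′ = Vec.tabulate (λ e → lookup M′ (old-edge e))

  restrict-lookup : ∀ M′ e → lookup (restrict M′) e ≡ lookup M′ (old-edge e)
  restrict-lookup M′ e = lookup∘tabulate (λ e → lookup M′ (old-edge e)) e

  restrict-lift : ∀ {M′} → IsPM H M′ →
    lookup M′ t₂₃ ≡ lookup M′ (old-edge e₁) → lookup M′ t₁₃ ≡ lookup M′ (old-edge e₂) → lookup M′ t₁₂ ≡ lookup M′ (old-edge e₃) →
    χ M′ (old-edge e₁) + χ M′ (old-edge e₂) + χ M′ (old-edge e₃) ≡ 1 → IsPM G (restrict M′) × M′ ≡ lift (restrict M′)
  restrict-lift {M′} pm′ t₂₃≡ t₁₃≡ t₁₂≡ one-at-u = ((λ _ _ → (λ ()) , (λ ())) , λ v _ → degree v) , subset-ext agrees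
    where
    M : Subset E
    M = restrict M′
    degree : ∀ v → degIn G M v ≡ 1
    degree v with v ≟ u
    ... | yes refl = trans (degIn-u M) (trans (cong₂ _+_ (cong₂ _+_ (cong bit (restrict-lookup M′ e₁)) (cong bit (restrict-lookup M′ e₂)))
                                                      (cong bit (restrict-lookup M′ e₃))) one-at-u)
    ... | no v≢u = begin
      degIn G M v                                                 ≡⟨ degIn-sum G M v ⟩
      sum (λ e → χ M e * 𝟙 (incident? G e v))                     ≡⟨ sum-cong-≗ (λ e → cong (λ b → bit b * 𝟙 (incident? G e v)) (restrict-lookup M′ e)) ⟩
      sum (λ e → χ M′ (old-edge e) * 𝟙 (incident? G e v))         ≡⟨ degIn-H-old M′ v≢u ⟨
      degIn H M′ (old v)                                          ≡⟨ proj₂ pm′ (old v) (λ ()) ⟩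
      1                                                           ∎
      where open ≡-Reasoning
    agrees : ∀ f → lookup M′ f ≡ lookup (lift M) f
    agrees f with edge-view f
    ... | old-edge-of e = sym (trans (lift-old M e) (restrict-lookup M′ e))
    ... | new-t₁₂ = trans t₁₂≡ (sym (trans (lift-t₁₂ M) (restrict-lookup M′ e₃)))
    ... | new-t₂₃ = trans t₂₃≡ (sym (trans (lift-t₂₃ M) (restrict-lookup M′ e₁)))
    ... | new-t₁₃ = trans t₁₃≡ (sym (trans (lift-t₁₃ M) (restrict-lookup M′ e₂)))

  restrict-away : Subset (E + 3) → Subset E
  restrict-away M′ = Vec.tabulate (λ e → not (at-u? e) ∧ lookup M′ (old-edge e))

  restrict-away-elsewhere : ∀ M′ {e} → e ≢ e₁ → e ≢ e₂ → e ≢ e₃ → lookup (restrict-away M′) e ≡ lookup M′ (old-edge e)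
  restrict-away-elsewhere M′ {e} p q r
    rewrite lookup∘tabulate (λ e → not (at-u? e) ∧ lookup M′ (old-edge e)) e | at-u?-elsewhere p q r = refl

  restrict-away-at-u : ∀ M′ {e} → Incident G e u → lookup (restrict-away M′) e ≡ false
  restrict-away-at-u M′ {e} e∋u
    rewrite lookup∘tabulate (λ e → not (at-u? e) ∧ lookup M′ (old-edge e)) e | at-u?-incident e∋u = refl

  degIn-restrict-away : ∀ {M′} → IsPM H M′ → ∀ v → ¬ ClosedNbhd G u v → degIn G (restrict-away M′) v ≡ 1
  degIn-restrict-away {M′} pm′ v v∉N[u] = begin
    degIn G M v                                                 ≡⟨ degIn-sum G M v ⟩
    sum (λ e → χ M e * 𝟙 (incident? G e v))                     ≡⟨ sum-cong-≗ pointwise ⟩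
    sum (λ e → χ M′ (old-edge e) * 𝟙 (incident? G e v))         ≡⟨ degIn-H-old M′ v≢u ⟨
    degIn H M′ (old v)                                          ≡⟨ proj₂ pm′ (old v) (λ ()) ⟩
    1                                                           ∎
    where
    open ≡-Reasoning
    M : Subset E
    M = restrict-away M′
    v≢u : v ≢ u
    v≢u = v∉N[u] ∘ inj₁
    unmatched : ∀ {e a} → Joins G e u a → 𝟙 (incident? G e v) ≡ 0
    unmatched {a = a} j = trans (𝟙-incident-far j v≢u) (𝟙-no (a ≟ v) λ where refl → v∉N[u] (inj₂ (_ , j)))
    both-zero : ∀ e → 𝟙 (incident? G e v) ≡ 0 → χ M e * 𝟙 (incident? G e v) ≡ χ M′ (old-edge e) * 𝟙 (incident? G e v)
    both-zero e z = trans (cong (χ M e *_) z)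
      (trans (*-zeroʳ (χ M e)) (sym (trans (cong (χ M′ (old-edge e) *_) z) (*-zeroʳ (χ M′ (old-edge e))))))
    pointwise : ∀ e → χ M e * 𝟙 (incident? G e v) ≡ χ M′ (old-edge e) * 𝟙 (incident? G e v)
    pointwise e with among₃ e₁ e₂ e₃ e
    ... | at₁ = both-zero e₁ (unmatched e₁-ua₁)
    ... | at₂ = both-zero e₂ (unmatched e₂-ua₂)
    ... | at₃ = both-zero e₃ (unmatched e₃-ua₃)
    ... | elsewhere p q r = cong (λ b → bit b * 𝟙 (incident? G e v)) (restrict-away-elsewhere M′ p q r)

  restrict-away-avoids : ∀ {M′} → IsPM H M′ →
    lookup M′ (old-edge e₁) ≡ true → lookup M′ (old-edge e₂) ≡ true → lookup M′ (old-edge e₃) ≡ true →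
    ∀ e → e ∈ restrict-away M′ → ¬ ClosedNbhd G u (endA G e) × ¬ ClosedNbhd G u (endB G e)
  restrict-away-avoids {M′} pm′ x₁ x₂ x₃ e e∈ with among₃ e₁ e₂ e₃ e | []=⇒lookup e∈
  ... | at₁ | e₁∈ = contradiction (trans (sym e₁∈) (restrict-away-at-u M′ e₁∋u)) λ ()
  ... | at₂ | e₂∈ = contradiction (trans (sym e₂∈) (restrict-away-at-u M′ e₂∋u)) λ ()
  ... | at₃ | e₃∈ = contradiction (trans (sym e₃∈) (restrict-away-at-u M′ e₃∋u)) λ ()
  ... | elsewhere p q r | e∈′ = matched-away (inj₁ refl) , matched-away (inj₂ refl)
    where
    e∈M′ : lookup M′ (old-edge e) ≡ true
    e∈M′ = trans (sym (restrict-away-elsewhere M′ p q r)) e∈′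
    unique-at : ∀ {f f′} w → lookup M′ f ≡ true → lookup M′ f′ ≡ true → Incident H f w → Incident H f′ w → f ≡ f′
    unique-at w = matched-edge-unique H pm′ w λ ()
    -- M′ already matches each old aᵢ by eᵢ
    matched-away : ∀ {x} → Incident G e x → ¬ ClosedNbhd G u x
    matched-away e∋x (inj₁ refl) = ¬incident-elsewhere p q r e∋x
    matched-away e∋x (inj₂ u~x) with neighbour-of-u u~x
    ... | inj₁ refl = p (↑ˡ-injective 3 e e₁ (unique-at (old a₁) e∈M′ x₁ (incident-away p q r e∋x) (joins⇒incidentʳ H e₁-b₁a₁)))
    ... | inj₂ (inj₁ refl) = q (↑ˡ-injective 3 e e₂ (unique-at (old a₂) e∈M′ x₂ (incident-away p q r e∋x) (joins⇒incidentʳ H e₂-b₂a₂)))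
    ... | inj₂ (inj₂ refl) = r (↑ˡ-injective 3 e e₃ (unique-at (old a₃) e∈M′ x₃ (incident-away p q r e∋x) (joins⇒incidentʳ H e₃-b₃a₃)))

  module ExtraMatching (M₀ : Subset E) (M₀-pm : IsPMMinus G (ClosedNbhd G u) M₀)
    (a₁≢a₂ : a₁ ≢ a₂) (a₁≢a₃ : a₁ ≢ a₃) (a₂≢a₃ : a₂ ≢ a₃) where

    M₀⁺ : Subset E
    M₀⁺ = Vec.tabulate (λ e → lookup M₀ e ∨ at-u? e)

    -- the perfect matching of H that is not a lift: M₀ together with the three pendant edges
    M★ : Subset (E + 3)
    M★ = M₀⁺ ++ (false ∷ false ∷ false ∷ [])

    M₀⁺-elsewhere : ∀ {e} → e ≢ e₁ → e ≢ e₂ → e ≢ e₃ → lookup M₀⁺ e ≡ lookup M₀ e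
    M₀⁺-elsewhere {e} p q r rewrite lookup∘tabulate (λ e → lookup M₀ e ∨ at-u? e) e | at-u?-elsewhere p q r =
      Bool.∨-identityʳ _

    M₀⁺-at-u : ∀ {e} → Incident G e u → lookup M₀⁺ e ≡ true
    M₀⁺-at-u {e} e∋u rewrite lookup∘tabulate (λ e → lookup M₀ e ∨ at-u? e) e | at-u?-incident e∋u =
      Bool.∨-zeroʳ _

    M₀-at-u : ∀ {e} → Incident G e u → χ M₀ e ≡ 0
    M₀-at-u {e} e∋u with lookup M₀ e in e∈M₀
    ... | false = refl
    ... | true with e∋u
    ...   | inj₁ refl = ⊥-elim (proj₁ (proj₁ M₀-pm e (lookup⇒[]= e M₀ e∈M₀)) (inj₁ refl))
    ...   | inj₂ refl = ⊥-elim (proj₂ (proj₁ M₀-pm e (lookup⇒[]= e M₀ e∈M₀)) (inj₁ refl))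

    degIn-M₀⁺ : ∀ {v} → v ≢ u → degIn G M₀⁺ v ≡ degIn G M₀ v + (𝟙 (a₁ ≟ v) + 𝟙 (a₂ ≟ v) + 𝟙 (a₃ ≟ v))
    degIn-M₀⁺ {v} v≢u = begin
      degIn G M₀⁺ v                                   ≡⟨ trans (degIn-sum G M₀⁺ v) (sum-at-u g⁺) ⟩
      rest g⁺ + g⁺ e₁ + g⁺ e₂ + g⁺ e₃                 ≡⟨ cong₂ _+_ (cong₂ _+_ (cong₂ _+_ rest-agrees (g⁺-at e₁-ua₁)) (g⁺-at e₂-ua₂)) (g⁺-at e₃-ua₃) ⟩
      rest g + 𝟙 (a₁ ≟ v) + 𝟙 (a₂ ≟ v) + 𝟙 (a₃ ≟ v)   ≡⟨ regroup (rest g) _ _ _ ⟩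
      rest g + (𝟙 (a₁ ≟ v) + 𝟙 (a₂ ≟ v) + 𝟙 (a₃ ≟ v)) ≡⟨ cong (_+ _) M₀-side ⟨
      degIn G M₀ v + (𝟙 (a₁ ≟ v) + 𝟙 (a₂ ≟ v) + 𝟙 (a₃ ≟ v))   ∎
      where
      open ≡-Reasoning
      g g⁺ : Fin E → ℕ
      g e = χ M₀ e * 𝟙 (incident? G e v)
      g⁺ e = χ M₀⁺ e * 𝟙 (incident? G e v)
      rest-agrees : rest g⁺ ≡ rest g
      rest-agrees = rest-cong g⁺ g λ e p q r → cong (λ b → bit b * 𝟙 (incident? G e v)) (M₀⁺-elsewhere p q r)
      g⁺-at : ∀ {e a} → Joins G e u a → g⁺ e ≡ 𝟙 (a ≟ v)
      g⁺-at {e} j = trans (cong₂ (λ b i → bit b * i) (M₀⁺-at-u (joins⇒incidentˡ G j)) (𝟙-incident-far j v≢u)) (+-identityʳ _)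
      g-at : ∀ {e} → Incident G e u → g e ≡ 0
      g-at {e} e∋u = cong (_* 𝟙 (incident? G e v)) (M₀-at-u e∋u)
      M₀-side : degIn G M₀ v ≡ rest g
      M₀-side = begin
        degIn G M₀ v                    ≡⟨ trans (degIn-sum G M₀ v) (sum-at-u g) ⟩
        rest g + g e₁ + g e₂ + g e₃     ≡⟨ cong₂ _+_ (cong₂ _+_ (cong (rest g +_) (g-at e₁∋u)) (g-at e₂∋u)) (g-at e₃∋u) ⟩
        rest g + 0 + 0 + 0              ≡⟨ plus-zeros (rest g) ⟩
        rest g                          ∎
        where
        plus-zeros : ∀ r → r + 0 + 0 + 0 ≡ r
        plus-zeros = solve-∀
      regroup : ∀ r x y z → r + x + y + z ≡ r + (x + y + z)
      regroup = solve-∀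

    M★-old : ∀ e → lookup M★ (old-edge e) ≡ lookup M₀⁺ e
    M★-old e = lookup-++ˡ M₀⁺ _ e

    M★-t₁₂ : lookup M★ t₁₂ ≡ false
    M★-t₁₂ = lookup-++ʳ M₀⁺ _ zero
    M★-t₂₃ : lookup M★ t₂₃ ≡ false
    M★-t₂₃ = lookup-++ʳ M₀⁺ _ (suc zero)
    M★-t₁₃ : lookup M★ t₁₃ ≡ false
    M★-t₁₃ = lookup-++ʳ M₀⁺ _ (suc (suc zero))

    M★-pm : IsPM H M★
    M★-pm = pm-H at-old
      (at-copy (degIn-H-b₁ M★) e₁∋u M★-t₁₂ M★-t₁₃)
      (at-copy (degIn-H-b₂ M★) e₂∋u M★-t₁₂ M★-t₂₃)
      (at-copy (degIn-H-b₃ M★) e₃∋u M★-t₂₃ M★-t₁₃)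
      where
      at-copy : ∀ {b e f g} → degIn H M★ b ≡ χ M★ (old-edge e) + χ M★ f + χ M★ g → Incident G e u →
        lookup M★ f ≡ false → lookup M★ g ≡ false → degIn H M★ b ≡ 1
      at-copy {e = e} deg≡ e∋u f∉ g∉ rewrite deg≡ | M★-old e | M₀⁺-at-u e∋u | f∉ | g∉ = refl
      at-old : ∀ {v} → v ≢ u → degIn H M★ (old v) ≡ 1
      at-old {v} v≢u = trans (degIn-H-old M★ v≢u)
        (trans (sum-cong-≗ λ e → cong (λ b → bit b * 𝟙 (incident? G e v)) (M★-old e))
        (trans (sym (degIn-sum G M₀⁺ v)) (trans (degIn-M₀⁺ v≢u) (count v≢u))))
        where
        avoided : ∀ {a} → Adjacent G u a → degIn G M₀ a ≡ 0
        avoided u~a = degIn-avoided G M₀-pm (inj₂ u~a)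
        count : ∀ {v} → v ≢ u → degIn G M₀ v + (𝟙 (a₁ ≟ v) + 𝟙 (a₂ ≟ v) + 𝟙 (a₃ ≟ v)) ≡ 1
        count {v} v≢u with v ≟ a₁ | v ≟ a₂ | v ≟ a₃
        ... | yes refl | _ | _
          rewrite avoided u~a₁ | 𝟙-yes (a₁ ≟ a₁) refl | 𝟙-no (a₂ ≟ a₁) (a₁≢a₂ ∘ sym) | 𝟙-no (a₃ ≟ a₁) (a₁≢a₃ ∘ sym) = refl
        ... | no v≢a₁ | yes refl | _
          rewrite avoided u~a₂ | 𝟙-no (a₁ ≟ a₂) a₁≢a₂ | 𝟙-yes (a₂ ≟ a₂) refl | 𝟙-no (a₃ ≟ a₂) (a₂≢a₃ ∘ sym) = refl
        ... | no v≢a₁ | no v≢a₂ | yes refl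
          rewrite avoided u~a₃ | 𝟙-no (a₁ ≟ a₃) a₁≢a₃ | 𝟙-no (a₂ ≟ a₃) a₂≢a₃ | 𝟙-yes (a₃ ≟ a₃) refl = refl
        ... | no v≢a₁ | no v≢a₂ | no v≢a₃
          rewrite proj₂ M₀-pm v (∉N[u] v≢u v≢a₁ v≢a₂ v≢a₃)
                | 𝟙-no (a₁ ≟ v) (v≢a₁ ∘ sym) | 𝟙-no (a₂ ≟ v) (v≢a₂ ∘ sym) | 𝟙-no (a₃ ≟ v) (v≢a₃ ∘ sym) = refl

    module _ (M₀-unique : ∀ M → IsPMMinus G (ClosedNbhd G u) M → M ≡ M₀) where

      ≡M★ : ∀ {M′} → IsPM H M′ →
        lookup M′ (old-edge e₁) ≡ true → lookup M′ (old-edge e₂) ≡ true → lookup M′ (old-edge e₃) ≡ true →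
        lookup M′ t₁₂ ≡ false → lookup M′ t₂₃ ≡ false → lookup M′ t₁₃ ≡ false → M′ ≡ M★
      ≡M★ {M′} pm′ x₁ x₂ x₃ f₁₂ f₂₃ f₁₃ = subset-ext agrees
        where
        restriction≡M₀ : restrict-away M′ ≡ M₀
        restriction≡M₀ = M₀-unique (restrict-away M′) (restrict-away-avoids pm′ x₁ x₂ x₃ , degIn-restrict-away pm′)

        agrees : ∀ f → lookup M′ f ≡ lookup M★ f
        agrees f with edge-view f
        ... | new-t₁₂ = trans f₁₂ (sym M★-t₁₂)
        ... | new-t₂₃ = trans f₂₃ (sym M★-t₂₃)
        ... | new-t₁₃ = trans f₁₃ (sym M★-t₁₃)
        ... | old-edge-of e with among₃ e₁ e₂ e₃ e
        ...   | at₁ = trans x₁ (sym (trans (M★-old e₁) (M₀⁺-at-u e₁∋u)))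
        ...   | at₂ = trans x₂ (sym (trans (M★-old e₂) (M₀⁺-at-u e₂∋u)))
        ...   | at₃ = trans x₃ (sym (trans (M★-old e₃) (M₀⁺-at-u e₃∋u)))
        ...   | elsewhere p q r = begin
          lookup M′ (old-edge e)          ≡⟨ restrict-away-elsewhere M′ p q r ⟨
          lookup (restrict-away M′) e     ≡⟨ cong (λ M → lookup M e) restriction≡M₀ ⟩
          lookup M₀ e                     ≡⟨ M₀⁺-elsewhere p q r ⟨
          lookup M₀⁺ e                    ≡⟨ M★-old e ⟨
          lookup M★ (old-edge e)          ∎
          where open ≡-Reasoning

      pm-H-cases : ∀ {M′} → IsPM H M′ → M′ ≡ M★ ⊎ ∃ λ M → IsPM G M × M′ ≡ lift M
      pm-H-cases {M′} pm′ with triangle-bits (lookup M′ (old-edge e₁)) (lookup M′ (old-edge e₂)) (lookup M′ (old-edge e₃))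
                                 (lookup M′ t₁₂) (lookup M′ t₂₃) (lookup M′ t₁₃)
                                 (trans (sym (degIn-H-b₁ M′)) (proj₂ pm′ b₁ λ ()))
                                 (trans (sym (degIn-H-b₂ M′)) (proj₂ pm′ b₂ λ ()))
                                 (trans (sym (degIn-H-b₃ M′)) (proj₂ pm′ b₃ λ ()))
      ... | inj₁ (x₁ , x₂ , x₃ , f₁₂ , f₂₃ , f₁₃) = inj₁ (≡M★ pm′ x₁ x₂ x₃ f₁₂ f₂₃ f₁₃)
      ... | inj₂ (t₂₃≡ , t₁₃≡ , t₁₂≡ , one-at-u) = inj₂ (restrict M′ , restrict-lift pm′ t₂₃≡ t₁₃≡ t₁₂≡ one-at-u)

      M★≢lift : ∀ {M} → IsPM G M → M★ ≢ lift M
      M★≢lift {M} pm M★≡ = contradiction (pm-at-u pm) none-at-u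
        where
        unused : ∀ {f e} → lookup M★ f ≡ false → lookup (lift M) f ≡ lookup M e → lookup M e ≡ false
        unused {f} f∉M★ f≡e = trans (sym f≡e) (trans (cong (λ M′ → lookup M′ f) (sym M★≡)) f∉M★)
        none-at-u : χ M e₁ + χ M e₂ + χ M e₃ ≢ 1
        none-at-u rewrite unused M★-t₂₃ (lift-t₂₃ M) | unused M★-t₁₃ (lift-t₁₃ M) | unused M★-t₁₂ (lift-t₁₂ M) = λ ()

      count-pm-H : ∀ {k} → NumPM G k → NumPM H (suc k)
      count-pm-H (Ms , unique , length≡k , Ms⇔pm) =
        M★ ∷ map lift Ms ,
        All.map⁺ (All.tabulate λ {M} M∈Ms → M★≢lift (Equivalence.to (Ms⇔pm M) M∈Ms)) ∷ Unique.map⁺ lift-injective unique ,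
        cong suc (trans (length-map lift Ms) length≡k) ,
        λ M′ → mk⇔ listed⇒pm (pm⇒listed M′)
        where
        listed⇒pm : ∀ {M′} → M′ List.∈ (M★ ∷ map lift Ms) → IsPM H M′
        listed⇒pm (here refl) = M★-pm
        listed⇒pm (there M′∈) with List.∈-map⁻ lift M′∈
        ... | M , M∈Ms , refl = lift-pm (Equivalence.to (Ms⇔pm M) M∈Ms)
        pm⇒listed : ∀ M′ → IsPM H M′ → M′ List.∈ (M★ ∷ map lift Ms)
        pm⇒listed M′ pm′ with pm-H-cases pm′
        ... | inj₁ refl = here refl
        ... | inj₂ (M , pm , refl) = there (List.∈-map⁺ lift (Equivalence.from (Ms⇔pm M) pm))

  -- The inserted graph is a brick

  triangle-not-bipartite : ¬ Bipartite H
  triangle-not-bipartite (colour , proper) =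
    odd-cycle (colour b₁) (colour b₂) (colour b₃) (bipartite-joins H colour proper t₁₂-b₁b₂)
      (bipartite-joins H colour proper t₂₃-b₂b₃) (bipartite-joins H colour proper t₁₃-b₁b₃)
    where
    odd-cycle : ∀ x y z → x ≢ y → y ≢ z → x ≢ z → ⊥
    odd-cycle true true _ x≢y _ _ = x≢y refl
    odd-cycle false false _ x≢y _ _ = x≢y refl
    odd-cycle true false true _ _ x≢z = x≢z refl
    odd-cycle true false false _ y≢z _ = y≢z refl
    odd-cycle false true true _ y≢z _ = y≢z refl
    odd-cycle false true false _ _ x≢z = x≢z refl

  reach-old : ∀ {v w} → Reach G v w → Reach H (old v) (old w)
  reach-old here = here
  reach-old (step r (e , j)) = reach-trans (reach-old r) (edge-old j)
    where
    b₁⇝a₁ : Reach H b₁ (old a₁)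
    b₁⇝a₁ = reach-edge e₁-b₁a₁
    b₁⇝a₂ : Reach H b₁ (old a₂)
    b₁⇝a₂ = reach-trans (reach-edge t₁₂-b₁b₂) (reach-edge e₂-b₂a₂)
    b₁⇝a₃ : Reach H b₁ (old a₃)
    b₁⇝a₃ = reach-trans (reach-edge t₁₃-b₁b₃) (reach-edge e₃-b₃a₃)
    either-way : ∀ {e a x y} → Joins G e u a → Reach H b₁ (old a) → Joins G e x y → Reach H (old x) (old y)
    either-way jᵤ b₁⇝a j with joins-unique G jᵤ j
    ... | inj₁ (refl , refl) = b₁⇝a
    ... | inj₂ (refl , refl) = reach-sym b₁⇝a
    edge-old : ∀ {e x y} → Joins G e x y → Reach H (old x) (old y)
    edge-old {e} j with among₃ e₁ e₂ e₃ e
    ... | at₁ = either-way e₁-ua₁ b₁⇝a₁ j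
    ... | at₂ = either-way e₂-ua₂ b₁⇝a₂ j
    ... | at₃ = either-way e₃-ua₃ b₁⇝a₃ j
    ... | elsewhere p q r with joins-unique G (joins-ends G e) j
    ...   | inj₁ (refl , refl) = reach-edge (joins-away p q r)
    ...   | inj₂ (refl , refl) = reach-edge (joins-sym H (joins-away p q r))

  connected-H : Connected G → Connected H
  connected-H connected x y = reach-trans (to-b₁ (vertex-view x)) (reach-sym (to-b₁ (vertex-view y)))
    where
    to-b₁ : ∀ {w} → VertexOfH w → Reach H w b₁
    to-b₁ (old-vertex v) = reach-old (connected v u)
    to-b₁ new-b₂ = reach-sym (reach-edge t₁₂-b₁b₂)
    to-b₁ new-b₃ = reach-sym (reach-edge t₁₃-b₁b₃)

  covered-H : (∀ e → ∃ λ M → IsPM G M × e ∈ M) → ∀ f → ∃ λ M → IsPM H M × f ∈ M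
  covered-H covered f = covering (edge-view f)
    where
    lifted : ∀ {f} e → (∀ M → lookup (lift M) f ≡ lookup M e) → ∃ λ M → IsPM H M × f ∈ M
    lifted {f} e f↦e with covered e
    ... | M , pm , e∈M = lift M , lift-pm pm , lookup⇒[]= f (lift M) (trans (f↦e M) ([]=⇒lookup e∈M))
    covering : ∀ {f} → EdgeOfH f → ∃ λ M → IsPM H M × f ∈ M
    covering (old-edge-of e) = lifted e (λ M → lift-old M e)
    covering new-t₁₂ = lifted e₃ lift-t₁₂
    covering new-t₂₃ = lifted e₁ lift-t₂₃
    covering new-t₁₃ = lifted e₂ lift-t₁₃

  parity : Subset (N + 2) → Bool
  parity X = (lookup X b₁ xor lookup X b₂) xor lookup X b₃

  -- the cut of G obtained by shrinking the triangle of H back to u (the parity decides on which side u lies)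
  contract : Subset (N + 2) → Subset N
  contract X = Vec.tabulate λ v → if does (v ≟ u) then parity X else lookup X (old v)

  contract-u : ∀ X → lookup (contract X) u ≡ parity X
  contract-u X rewrite lookup∘tabulate (λ v → if does (v ≟ u) then parity X else lookup X (old v)) u with u ≟ u
  ... | yes _ = refl
  ... | no u≢u = ⊥-elim (u≢u refl)

  contract-old : ∀ X {v} → v ≢ u → lookup (contract X) v ≡ lookup X (old v)
  contract-old X {v} v≢u rewrite lookup∘tabulate (λ v → if does (v ≟ u) then parity X else lookup X (old v)) v with v ≟ u
  ... | yes v≡u = ⊥-elim (v≢u v≡u)
  ... | no _ = refl

  cutIn-at-u : ∀ Y M → cutIn G Y M ≡ rest (λ e → χ M e * bit (crosses G Y e))
    + χ M e₁ * bit (lookup Y u xor lookup Y a₁) + χ M e₂ * bit (lookup Y u xor lookup Y a₂) + χ M e₃ * bit (lookup Y u xor lookup Y a₃)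
  cutIn-at-u Y M = trans (cutIn-sum G Y M) (trans (sum-at-u _)
    (cong₂ _+_ (cong₂ _+_ (cong (rest (λ e → χ M e * bit (crosses G Y e)) +_) (at e₁-ua₁)) (at e₂-ua₂)) (at e₃-ua₃)))
    where
    at : ∀ {e a} → Joins G e u a → χ M e * bit (crosses G Y e) ≡ χ M e * bit (lookup Y u xor lookup Y a)
    at {e} j = cong (λ b → χ M e * bit b) (crosses-joins G j Y)

  cutIn-lift : ∀ X M → cutIn H X (lift M) ≡ rest (λ e → χ M e * bit (crosses H X (old-edge e)))
    + χ M e₁ * bit (lookup X b₁ xor lookup X (old a₁)) + χ M e₂ * bit (lookup X b₂ xor lookup X (old a₂))
    + χ M e₃ * bit (lookup X b₃ xor lookup X (old a₃))
    + (χ M e₃ * bit (lookup X b₁ xor lookup X b₂) + (χ M e₁ * bit (lookup X b₂ xor lookup X b₃)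
      + (χ M e₂ * bit (lookup X b₁ xor lookup X b₃) + 0)))
  cutIn-lift X M = trans (cutIn-sum H X (lift M)) (trans (sum-++ E 3 _) (cong₂ _+_
    (trans (sum-cong-≗ λ e → cong (λ b → bit b * bit (crosses H X (old-edge e))) (lift-old M e))
      (trans (sum-at-u _) (cong₂ _+_ (cong₂ _+_ (cong (rest (λ e → χ M e * bit (crosses H X (old-edge e))) +_) (at e₁-b₁a₁))
                                               (at e₂-b₂a₂)) (at e₃-b₃a₃))))
    (cong₂ _+_ (triangle (lift-t₁₂ M) t₁₂-b₁b₂)
      (cong₂ _+_ (triangle (lift-t₂₃ M) t₂₃-b₂b₃) (cong (_+ 0) (triangle (lift-t₁₃ M) t₁₃-b₁b₃))))))
    where
    at : ∀ {e b a} → Joins H (old-edge e) b (old a) →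
      χ M e * bit (crosses H X (old-edge e)) ≡ χ M e * bit (lookup X b xor lookup X (old a))
    at {e} j = cong (λ c → χ M e * bit c) (crosses-joins H j X)
    triangle : ∀ {t e b b′} → lookup (lift M) t ≡ lookup M e → Joins H t b b′ →
      χ (lift M) t * bit (crosses H X t) ≡ χ M e * bit (lookup X b xor lookup X b′)
    triangle t↦e j = cong₂ (λ x c → bit x * bit c) t↦e (crosses-joins H j X)

  rest-contract : ∀ X M → rest (λ e → χ M e * bit (crosses H X (old-edge e))) ≡ rest (λ e → χ M e * bit (crosses G (contract X) e))
  rest-contract X M = rest-cong _ _ λ e p q r → cong (λ c → χ M e * bit c) (begin
    crosses H X (old-edge e)                                  ≡⟨ crosses-joins H (joins-away p q r) X ⟩
    lookup X (old (endA G e)) xor lookup X (old (endB G e))   ≡⟨ cong₂ _xor_ (sym (contract-old X (¬incident-elsewhere p q r ∘ inj₁)))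
                                                                             (sym (contract-old X (¬incident-elsewhere p q r ∘ inj₂))) ⟩
    crosses G (contract X) e                                  ∎)
    where open ≡-Reasoning

  contract-tight : ∀ {X} → TightCut H X → TightCut G (contract X)
  contract-tight {X} tight M pm
    rewrite cutIn-at-u (contract X) M | contract-u X
          | contract-old X (far-end-≢u e₁-ua₁) | contract-old X (far-end-≢u e₂-ua₂) | contract-old X (far-end-≢u e₃-ua₃)
          | sym (rest-contract X M) =
    parity-transfer (rest (λ e → χ M e * bit (crosses H X (old-edge e)))) (lookup X b₁) (lookup X b₂) (lookup X b₃) (lookup X (old a₁)) (lookup X (old a₂)) (lookup X (old a₃))
      (one₃ (lookup M e₁) (lookup M e₂) (lookup M e₃) (pm-at-u pm)) (trans (sym (cutIn-lift X M)) (tight (lift M) (lift-pm pm)))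

  off-u : Subset (N + 2) → ℕ
  off-u X = sum (erase u (λ v → χ X (old v)))

  ∣X∣-split : ∀ X → ∣ X ∣ ≡ χ X b₁ + off-u X + (χ X b₂ + (χ X b₃ + 0))
  ∣X∣-split X = trans (∣∣-sum X) (trans (sum-++ N 2 _) (cong (_+ (χ X b₂ + (χ X b₃ + 0))) (sum-erase (λ v → χ X (old v)) u)))

  ∣contract∣ : ∀ X → ∣ contract X ∣ ≡ bit (parity X) + off-u X
  ∣contract∣ X = trans (∣∣-sum (contract X)) (trans (sum-erase _ u) (cong₂ _+_ (cong bit (contract-u X))
    (sum-cong-≗ λ v → erase-cong u _ _ v λ v≢u → cong bit (contract-old X v≢u))))

  off-u≡0 : ∀ X → off-u X ≡ 0 → ∀ {v} → v ≢ u → lookup X (old v) ≡ false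
  off-u≡0 X off≡0 {v} v≢u = bit≡0⇒ (trans (sym (erase-≢ (λ v → χ X (old v)) v≢u)) (sum≡0⇒ _ off≡0 v))

  off-u≡1 : ∀ X → off-u X ≡ 1 → ∃ λ w → ∀ {v} → v ≢ u → v ≢ w → lookup X (old v) ≡ false
  off-u≡1 X off≡1 with sum≡1⇒ _ off≡1
  ... | w , _ , only-w = w , λ {v} v≢u v≢w → bit≡0⇒ (trans (sym (erase-≢ (λ v → χ X (old v)) v≢u)) (only-w v v≢w))

  module _ (covered : ∀ e → ∃ λ M → IsPM G M × e ∈ M)
    (M₀ : Subset E) (M₀-pm : IsPMMinus G (ClosedNbhd G u) M₀)
    (a₁≢a₂ : a₁ ≢ a₂) (a₁≢a₃ : a₁ ≢ a₃) (a₂≢a₃ : a₂ ≢ a₃) where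

    open ExtraMatching M₀ M₀-pm a₁≢a₂ a₁≢a₃ a₂≢a₃

    module _ {X} (tight : TightCut H X) where

      -- if the triangle edge opposite bᵢ crosses X, then the pendant edge eᵢ does not:
      -- both lie in the lift of a perfect matching of G using eᵢ
      pendant-inside : ∀ {e b a} i → (∀ M → lookup (lift M) (E ↑ʳ i) ≡ lookup M e) → Joins H (old-edge e) b (old a) →
        crosses H X (E ↑ʳ i) ≡ true → (lookup X b xor lookup X (old a)) ≡ false
      pendant-inside {e} {b} {a} i t↦e j t-crosses with covered e
      ... | M , pm , e∈M with lookup X b xor lookup X (old a) in e-crosses
      ...   | false = refl
      ...   | true = ⊥-elim (↑ˡ≢↑ʳ e i (crossing-unique H (tight (lift M) (lift-pm pm))
                (trans (lift-old M e) ([]=⇒lookup e∈M)) (trans (t↦e M) ([]=⇒lookup e∈M))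
                (trans (crosses-joins H j X) e-crosses) t-crosses))

      pinned : ∀ {w b a} → (∀ {v} → v ≢ u → v ≢ w → lookup X (old v) ≡ false) → a ≢ u → lookup X b ≡ true →
        (lookup X b xor lookup X (old a)) ≡ false → a ≡ w
      pinned {w} {b} {a} outside a≢u b∈X same with a ≟ w
      ... | yes a≡w = a≡w
      ... | no a≢w = contradiction (trans (sym same) (cong₂ _xor_ b∈X (outside a≢u a≢w))) λ ()

      crossing : ∀ {t b b′ x y} → Joins H t b b′ → lookup X b ≡ x → lookup X b′ ≡ y → crosses H X t ≡ (x xor y)
      crossing j p q = trans (crosses-joins H j X) (cong₂ _xor_ p q)

      singleton-if-contraction-singleton : ∣ contract X ∣ ≡ 1 → ∣ X ∣ ≡ 1
      singleton-if-contraction-singleton ∣Y∣≡1 =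
        trans (∣X∣-split X) (cases _ _ _ refl refl refl (trans (sym (∣contract∣ X)) ∣Y∣≡1))
        where
        forced₁ : crosses H X t₂₃ ≡ true → (lookup X b₁ xor lookup X (old a₁)) ≡ false
        forced₁ = pendant-inside (suc zero) lift-t₂₃ e₁-b₁a₁
        forced₂ : crosses H X t₁₃ ≡ true → (lookup X b₂ xor lookup X (old a₂)) ≡ false
        forced₂ = pendant-inside (suc (suc zero)) lift-t₁₃ e₂-b₂a₂
        forced₃ : crosses H X t₁₂ ≡ true → (lookup X b₃ xor lookup X (old a₃)) ≡ false
        forced₃ = pendant-inside zero lift-t₁₂ e₃-b₃a₃
        cases : ∀ x₁ x₂ x₃ → lookup X b₁ ≡ x₁ → lookup X b₂ ≡ x₂ → lookup X b₃ ≡ x₃ →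
          bit ((x₁ xor x₂) xor x₃) + off-u X ≡ 1 → bit x₁ + off-u X + (bit x₂ + (bit x₃ + 0)) ≡ 1
        cases true false false _ _ _ h rewrite suc-injective h = refl
        cases false true false _ _ _ h rewrite suc-injective h = refl
        cases false false true _ _ _ h rewrite suc-injective h = refl
        cases false false false _ _ _ h rewrite h = refl
        -- all of the triangle in X, nothing else: M★ would cross X three times
        cases true true true q₁ q₂ q₃ h = ⊥-elim (e₁≢e₂ (↑ˡ-injective 3 e₁ e₂
          (crossing-unique H (tight M★ M★-pm) (M★∋ e₁∋u) (M★∋ e₂∋u)
            (crossing e₁-b₁a₁ q₁ (outside (far-end-≢u e₁-ua₁))) (crossing e₂-b₂a₂ q₂ (outside (far-end-≢u e₂-ua₂))))))
          where
          outside : ∀ {v} → v ≢ u → lookup X (old v) ≡ false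
          outside = off-u≡0 X (suc-injective h)
          M★∋ : ∀ {e} → Incident G e u → lookup M★ (old-edge e) ≡ true
          M★∋ {e} e∋u = trans (M★-old e) (M₀⁺-at-u e∋u)
        cases true true false q₁ q₂ q₃ h with off-u≡1 X h
        ... | w , outside = ⊥-elim (a₁≢a₂ (trans
          (pinned outside (far-end-≢u e₁-ua₁) q₁ (forced₁ (crossing t₂₃-b₂b₃ q₂ q₃)))
          (sym (pinned outside (far-end-≢u e₂-ua₂) q₂ (forced₂ (crossing t₁₃-b₁b₃ q₁ q₃))))))
        cases true false true q₁ q₂ q₃ h with off-u≡1 X h
        ... | w , outside = ⊥-elim (a₁≢a₃ (trans
          (pinned outside (far-end-≢u e₁-ua₁) q₁ (forced₁ (crossing t₂₃-b₂b₃ q₂ q₃)))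
          (sym (pinned outside (far-end-≢u e₃-ua₃) q₃ (forced₃ (crossing t₁₂-b₁b₂ q₁ q₂))))))
        cases false true true q₁ q₂ q₃ h with off-u≡1 X h
        ... | w , outside = ⊥-elim (a₂≢a₃ (trans
          (pinned outside (far-end-≢u e₂-ua₂) q₂ (forced₂ (crossing t₁₃-b₁b₃ q₁ q₃)))
          (sym (pinned outside (far-end-≢u e₃-ua₃) q₃ (forced₃ (crossing t₁₂-b₁b₂ q₁ q₂))))))

    contract-∁ : ∀ X v → lookup (contract (∁ X)) v ≡ not (lookup (contract X) v)
    contract-∁ X v with v ≟ u
    ... | yes refl = begin
      lookup (contract (∁ X)) u                                        ≡⟨ contract-u (∁ X) ⟩
      (lookup (∁ X) b₁ xor lookup (∁ X) b₂) xor lookup (∁ X) b₃        ≡⟨ cong₂ _xor_ (cong₂ _xor_ (lookup-map b₁ not X) (lookup-map b₂ not X)) (lookup-map b₃ not X) ⟩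
      (not (lookup X b₁) xor not (lookup X b₂)) xor not (lookup X b₃)  ≡⟨ cong (_xor not (lookup X b₃)) (Bool.xor-annihilates-not (lookup X b₁) _) ⟩
      parity′ xor not (lookup X b₃)                                    ≡⟨ Bool.not-distribʳ-xor parity′ _ ⟨
      not (parity X)                                                   ≡⟨ cong not (contract-u X) ⟨
      not (lookup (contract X) u)                                      ∎
      where
      open ≡-Reasoning
      parity′ : Bool
      parity′ = lookup X b₁ xor lookup X b₂
    ... | no v≢u = trans (contract-old (∁ X) v≢u) (trans (lookup-map (old v) not X) (cong not (sym (contract-old X v≢u))))

    tight-cuts-trivial : (∀ Y → TightCut G Y → TrivialCut G Y) → ∀ X → TightCut H X → TrivialCut H X
    tight-cuts-trivial trivial X tight with trivial (contract X) (contract-tight tight)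
    ... | inj₁ ∣Y∣≡1 = inj₁ (singleton-if-contraction-singleton tight ∣Y∣≡1)
    ... | inj₂ ∣∁Y∣≡1 = inj₂ (singleton-if-contraction-singleton tight∁ (trans ∣contract-∁∣ ∣∁Y∣≡1))
      where
      tight∁ : TightCut H (∁ X)
      tight∁ M pm = trans (cutIn-∁ H X M) (tight M pm)
      ∣contract-∁∣ : ∣ contract (∁ X) ∣ ≡ ∣ ∁ (contract X) ∣
      ∣contract-∁∣ = trans (∣∣-sum (contract (∁ X))) (trans (sum-cong-≗ λ v → cong bit (contract-∁ X v)) (sym (∣∁∣-sum (contract X))))

  extremal-H : Extremal G → NumPMMinus G (ClosedNbhd G u) 1 → Extremal H
  extremal-H (brick@(_ , (connected , 2≤n , covered) , trivial) , k , count , k+n≡m+1) M₀-count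
    with unique-member M₀-count
  ... | M₀ , M₀-pm , M₀-unique with neighbours-distinct brick M₀-pm
  ...   | a₁≢a₂ , a₁≢a₃ , a₂≢a₃ =
    (triangle-not-bipartite , (connected-H connected , ≤-trans 2≤n (m≤m+n N 2) , covered-H covered) ,
     tight-cuts-trivial covered M₀ M₀-pm a₁≢a₂ a₁≢a₃ a₂≢a₃ trivial) ,
    suc k , ExtraMatching.count-pm-H M₀ M₀-pm a₁≢a₂ a₁≢a₃ a₂≢a₃ M₀-unique count , excess-grows k N E k+n≡m+1

corollary2p4 : (G : Graph) → Loopless G → Extremal G →
  (u : Fin (n G)) → deg G u ≡ 3 →
  (e₁ e₂ e₃ : Fin (m G)) → e₁ ≢ e₂ → e₁ ≢ e₃ → e₂ ≢ e₃ →
  Incident G e₁ u → Incident G e₂ u → Incident G e₃ u →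
  NumPMMinus G (ClosedNbhd G u) 1 →
  Extremal (triangleInsert G u e₂ e₃)
corollary2p4 G loopless extremal u deg-u e₁ e₂ e₃ e₁≢e₂ e₁≢e₃ e₂≢e₃ e₁∋u e₂∋u e₃∋u =
  Insertion.extremal-H G loopless u deg-u e₁ e₂ e₃ e₁≢e₂ e₁≢e₃ e₂≢e₃ e₁∋u e₂∋u e₃∋u extremal
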